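{- Let $d,k,n$ be positive integers with $k\geq4$ and $d\geq k-1$, and write $V_n=\{1,\ldots,n\}\times\{1,2\}$ for the vertex set of $P_n\,\Box\,P_2$. (1) If $n\leq d$, then $\mathrm{gp}^k_d(P_n\,\Box\,P_2)=|B_{k,d}\cap V_n|$ if $1\leq n<2k-3$, and $\mathrm{gp}^k_d(P_n\,\Box\,P_2)=|A_{k,d}\cap V_n|$ if $n\geq 2k-3$. (2) If $n\geq d+1$ and $d<2k-3$, then $\mathrm{gp}^k_d(P_n\,\Box\,P_2)=|B_{k,d}\cap V_n|$. (3) If $n\geq d+1$ and $d\geq 2k-3$, then $\mathrm{gp}^k_d(P_n\,\Box\,P_2)=\max\bigl(|A_{k,d}\cap V_n|,\,|B_{k,d}\cap V_n|\bigr)$.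
   Context: $P_n\,\Box\,P_2$ is the grid with vertex set $\{1,\ldots,n\}\times\{1,2\}$, where $(i,j)$ and $(i',j')$ are adjacent iff either $j=j'$ and $|i-i'|=1$, or $i=i'$ and $j\neq j'$. For a graph $G$, a geodesic is a shortest path between two vertices; its length $\lambda(g)$ is its number of edges. For $d\ge1$, $k\ge2$, $S\subseteq V(G)$ is a $k$-general $d$-position set if every geodesic $g$ with $|S\cap V(g)|\geq k$ has $\lambda(g)>d$; $\mathrm{gp}^k_d(G)$ is the largest cardinality of such a set. For integers $d\ge1,k\ge2$ with $d\geq 2k-3$, define $A_{k,d}=\bigcup_{s\ge0}A_{k,d}(s)\subseteq\mathbb{Z}_{\ge1}\times\{1,2\}$, where $A_{k,d}(s)=\{(i,1+\frac{1+(-1)^{i+s}}{2}) : i\in[ds+1,ds+2k-3]\}$. For $d\geq k-2$, define $B_{k,d}=\bigcup_{s\ge0}[ds+1,ds+k-2]\times\{1,2\}$. Here $[a,b]$ denotes the set of integers $i$ with $a\le i\le b$. -}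

module Defs where

open import Data.Nat using (ℕ; zero; suc; _+_; _*_; _∸_; _≤_; _<_; _%_)
open import Data.Nat.Properties using () renaming (_≟_ to _≟ℕ_)
open import Data.Product using (Σ; ∃; ∃-syntax; _×_; _,_)
open import Data.Product.Properties using (≡-dec)
open import Data.Sum using (_⊎_)
open import Data.List using (List; []; _∷_; length; filter)
open import Data.List.Relation.Unary.All using (All)
open import Data.List.Relation.Unary.Any using (any?)
open import Data.List.Membership.Propositional using (_∈_)
open import Data.List.Relation.Unary.Unique.Propositional using (Unique)
open import Relation.Binary.PropositionalEquality using (_≡_; _≢_)
open import Relation.Binary.Definitions using (DecidableEquality)
open import Relation.Nullary using (¬_)
open import Function.Bundles using (_⇔_)

-- Vertices are pairs (i , j) of naturals, 1-based as in the paper.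
Vert : Set
Vert = ℕ × ℕ

_≟V_ : DecidableEquality Vert
_≟V_ = ≡-dec _≟ℕ_ _≟ℕ_

InV : ℕ → Vert → Set
InV n (i , j) = (1 ≤ i × i ≤ n) × (1 ≤ j × j ≤ 2)

-- adjacency of P_n □ P_2 (restricted to V_n in Walk below)
Adj : Vert → Vert → Set
Adj (i , j) (i' , j') = (j ≡ j' × (suc i ≡ i' ⊎ suc i' ≡ i)) ⊎ (i ≡ i' × j ≢ j')

data Walk (n : ℕ) : Vert → Vert → List Vert → Set where
  single : ∀ {u} → InV n u → Walk n u u (u ∷ [])
  step   : ∀ {u w v xs} → InV n u → Adj u w → Walk n w v xs → Walk n u v (u ∷ xs)

λ-len : List Vert → ℕ
λ-len xs = length xs ∸ 1

Geodesic : ℕ → List Vert → Set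
Geodesic n g = ∃[ u ] ∃[ v ] (Walk n u v g × (∀ h → Walk n u v h → λ-len g ≤ λ-len h))

-- |S ∩ V(g)|  (S a duplicate-free list of vertices)
countIn : List Vert → List Vert → ℕ
countIn S g = length (filter (λ x → any? (x ≟V_) g) S)

IsVSet : ℕ → List Vert → Set
IsVSet n S = Unique S × All (InV n) S

IsGenPos : ℕ → ℕ → ℕ → List Vert → Set
IsGenPos n k d S = IsVSet n S ×
  (∀ g → Geodesic n g → k ≤ countIn S g → d < λ-len g)

GpEq : ℕ → ℕ → ℕ → ℕ → Set
GpEq n k d m =
  (∃[ S ] (IsGenPos n k d S × length S ≡ m)) ×
  (∀ S → IsGenPos n k d S → length S ≤ m)

-- A_{k,d}; (1 + (-1)^(i+s))/2 = 1 ∸ ((i + s) % 2)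
InA : ℕ → ℕ → Vert → Set
InA k d (i , j) = ∃[ s ] ((d * s + 1 ≤ i × i ≤ d * s + (2 * k ∸ 3)) × j ≡ 1 + (1 ∸ ((i + s) % 2)))

InB : ℕ → ℕ → Vert → Set
InB k d (i , j) = ∃[ s ] ((d * s + 1 ≤ i × i ≤ d * s + (k ∸ 2)) × (1 ≤ j × j ≤ 2))

Card : (Vert → Set) → ℕ → Set
Card P m = ∃[ xs ] (Unique xs × (∀ x → (x ∈ xs) ⇔ P x) × length xs ≡ m)

-- A geodesic of P_n □ P_2 runs along one row, possibly crossing once to the other row, so it
-- lies on a row path or a turn path (a segment of one row followed by a segment of the other)
-- of the same length. B_{k,d}, and a set with the columns of A_{k,d} whose rows alternate along
-- these columns, meet every such path of length at most d in at most k - 1 vertices.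
-- Conversely, for a k-general d-position set S, the two turn paths switching rows at the fullest
-- column of a window of w ≤ d columns show that the number of vertices of S in the window plus
-- the largest column count is at most 2(k - 1). Cutting 1, …, n into blocks of d columns and
-- adding these window bounds gives |B_{k,d} ∩ V_n| when every window holds a full column, and
-- |A_{k,d} ∩ V_n| otherwise.

module Submission where

open import Data.Nat
open import Data.Nat.Properties
open import Data.Nat.DivMod
open import Data.Nat.Divisibility using (n∣m*n)
open import Data.Nat.Tactic.RingSolver using (solve-∀)
open import Algebra.Properties.CommutativeSemigroup +-commutativeSemigroup using () renaming (interchange to +-interchange)
open import Data.Product using (∃-syntax; _×_; _,_; proj₁; proj₂)
open import Data.Sum using (_⊎_; inj₁; inj₂)
open import Data.Empty using (⊥-elim)
open import Data.List using (List; []; _∷_; length; filter; _++_)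
open import Data.List.Properties using (length-++; filter-++)
open import Data.List.Relation.Unary.All as All using (All; []; _∷_)
open import Data.List.Relation.Unary.Any using (here; there)
open import Data.List.Relation.Unary.AllPairs using ([]; _∷_)
open import Data.List.Membership.Propositional using (_∈_)
import Data.List.Membership.Propositional.Properties as ∈
open import Data.List.Relation.Unary.Unique.Propositional using (Unique)
import Data.List.Relation.Unary.Unique.Propositional.Properties as Unique
open import Function using (_∘_)
open import Function.Bundles using (Equivalence)
open import Relation.Binary.PropositionalEquality
open import Relation.Nullary using (Dec; yes; no; ¬_; contradiction)
open import Relation.Nullary.Decidable using (_×-dec_)
open import Relation.Unary using (Decidable)
open import Defs
open import Data.List.Membership.DecPropositional _≟V_ using (_∈?_)

module _ {A : Set} where

  remove : ∀ {x : A} ys → x ∈ ys → List A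
  remove (y ∷ ys) (here _)  = ys
  remove (y ∷ ys) (there p) = y ∷ remove ys p

  length-remove : ∀ {x : A} ys (p : x ∈ ys) → suc (length (remove ys p)) ≡ length ys
  length-remove (y ∷ ys) (here _)  = refl
  length-remove (y ∷ ys) (there p) = cong suc (length-remove ys p)

  ∈-remove : ∀ {x z : A} ys (p : x ∈ ys) → z ∈ ys → z ≢ x → z ∈ remove ys p
  ∈-remove (y ∷ ys) (here refl) (here refl) z≢x = ⊥-elim (z≢x refl)
  ∈-remove (y ∷ ys) (here refl) (there q)   _   = q
  ∈-remove (y ∷ ys) (there p)   (here z≡y)  _   = here z≡y
  ∈-remove (y ∷ ys) (there p)   (there q)   z≢x = there (∈-remove ys p q z≢x)

  Unique-⊆⇒length≤ : ∀ {xs ys : List A} → Unique xs → (∀ {x} → x ∈ xs → x ∈ ys) → length xs ≤ length ys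
  Unique-⊆⇒length≤ {[]}     _              _   = z≤n
  Unique-⊆⇒length≤ {x ∷ xs} {ys} (x∉ ∷ uxs) xs⊆ys =
    subst (suc (length xs) ≤_) (length-remove ys x∈ys)
      (s≤s (Unique-⊆⇒length≤ uxs (λ z∈xs → ∈-remove ys x∈ys (xs⊆ys (there z∈xs)) (distinct z∈xs))))
    where
    x∈ys = xs⊆ys (here refl)
    distinct : ∀ {z} → z ∈ xs → z ≢ x
    distinct z∈xs refl = All.lookup x∉ z∈xs refl

  count : {P : A → Set} → Decidable P → List A → ℕ
  count P? xs = length (filter P? xs)

  count-++ : {P : A → Set} (P? : Decidable P) → ∀ xs ys → count P? (xs ++ ys) ≡ count P? xs + count P? ys
  count-++ P? xs ys = trans (cong length (filter-++ P? xs ys)) (length-++ (filter P? xs))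

𝟙 : ∀ {P : Set} → Dec P → ℕ
𝟙 (yes _) = 1
𝟙 (no _)  = 0

𝟙≤1 : ∀ {P : Set} (P? : Dec P) → 𝟙 P? ≤ 1
𝟙≤1 (yes _) = s≤s z≤n
𝟙≤1 (no _)  = z≤n

𝟙-×-dec : ∀ {P Q : Set} (P? : Dec P) (Q? : Dec Q) → 𝟙 (P? ×-dec Q?) ≡ 𝟙 P? * 𝟙 Q?
𝟙-×-dec (yes _) (yes _) = refl
𝟙-×-dec (yes _) (no _)  = refl
𝟙-×-dec (no _)  (yes _) = refl
𝟙-×-dec (no _)  (no _)  = refl

count-∷ : ∀ {A : Set} {P : A → Set} (P? : Decidable P) → ∀ x xs → count P? (x ∷ xs) ≡ 𝟙 (P? x) + count P? xs
count-∷ P? x xs with P? x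
... | yes _ = refl
... | no _  = refl

-- Sums and maxima over windows of consecutive columns

sumFrom : (ℕ → ℕ) → ℕ → ℕ → ℕ
sumFrom f l zero    = 0
sumFrom f l (suc w) = f l + sumFrom f (suc l) w

sumFrom-+ : ∀ f l w₁ w₂ → sumFrom f l (w₁ + w₂) ≡ sumFrom f l w₁ + sumFrom f (l + w₁) w₂
sumFrom-+ f l zero     w₂ = cong (λ l′ → sumFrom f l′ w₂) (sym (+-identityʳ l))
sumFrom-+ f l (suc w₁) w₂ = begin
  f l + sumFrom f (suc l) (w₁ + w₂)
    ≡⟨ cong (f l +_) (sumFrom-+ f (suc l) w₁ w₂) ⟩
  f l + (sumFrom f (suc l) w₁ + sumFrom f (suc l + w₁) w₂)
    ≡⟨ sym (+-assoc (f l) _ _) ⟩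
  f l + sumFrom f (suc l) w₁ + sumFrom f (suc l + w₁) w₂
    ≡⟨ cong (λ l′ → f l + sumFrom f (suc l) w₁ + sumFrom f l′ w₂) (sym (+-suc l w₁)) ⟩
  f l + sumFrom f (suc l) w₁ + sumFrom f (l + suc w₁) w₂ ∎
  where open ≡-Reasoning

sumFrom-suc : ∀ f l w → sumFrom f l (suc w) ≡ sumFrom f l w + f (l + w)
sumFrom-suc f l w = begin
  sumFrom f l (suc w)                   ≡⟨ cong (sumFrom f l) (+-comm 1 w) ⟩
  sumFrom f l (w + 1)                   ≡⟨ sumFrom-+ f l w 1 ⟩
  sumFrom f l w + (f (l + w) + 0)       ≡⟨ cong (sumFrom f l w +_) (+-identityʳ _) ⟩
  sumFrom f l w + f (l + w)             ∎
  where open ≡-Reasoning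

sumFrom-cong : ∀ f g l l′ w → (∀ i → i < w → f (l + i) ≡ g (l′ + i)) → sumFrom f l w ≡ sumFrom g l′ w
sumFrom-cong f g l l′ zero    eq = refl
sumFrom-cong f g l l′ (suc w) eq = cong₂ _+_
  (subst₂ (λ a b → f a ≡ g b) (+-identityʳ l) (+-identityʳ l′) (eq 0 (s≤s z≤n)))
  (sumFrom-cong f g (suc l) (suc l′) w λ i i<w →
    subst₂ (λ a b → f a ≡ g b) (+-suc l i) (+-suc l′ i) (eq (suc i) (s≤s i<w)))

sumFrom-+-distrib : ∀ f g l w → sumFrom (λ c → f c + g c) l w ≡ sumFrom f l w + sumFrom g l w
sumFrom-+-distrib f g l zero    = refl
sumFrom-+-distrib f g l (suc w) = begin
  f l + g l + sumFrom (λ c → f c + g c) (suc l) w       ≡⟨ cong (f l + g l +_) (sumFrom-+-distrib f g (suc l) w) ⟩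
  f l + g l + (sumFrom f (suc l) w + sumFrom g (suc l) w) ≡⟨ +-interchange (f l) (g l) _ _ ⟩
  f l + sumFrom f (suc l) w + (g l + sumFrom g (suc l) w) ∎
  where open ≡-Reasoning

sumFrom-monoʳ-≤ : ∀ f l {w w′} → w ≤ w′ → sumFrom f l w ≤ sumFrom f l w′
sumFrom-monoʳ-≤ f l {w} {w′} w≤w′ = begin
  sumFrom f l w                             ≤⟨ m≤m+n _ _ ⟩
  sumFrom f l w + sumFrom f (l + w) (w′ ∸ w) ≡⟨ sym (sumFrom-+ f l w (w′ ∸ w)) ⟩
  sumFrom f l (w + (w′ ∸ w))                ≡⟨ cong (sumFrom f l) (m+[n∸m]≡n w≤w′) ⟩
  sumFrom f l w′                            ∎
  where open ≤-Reasoning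

sumFrom-≤-* : ∀ f l w b → (∀ i → i < w → f (l + i) ≤ b) → sumFrom f l w ≤ w * b
sumFrom-≤-* f l zero    b bound = z≤n
sumFrom-≤-* f l (suc w) b bound = +-mono-≤
  (subst (λ c → f c ≤ b) (+-identityʳ l) (bound 0 (s≤s z≤n)))
  (sumFrom-≤-* f (suc l) w b λ i i<w → subst (λ c → f c ≤ b) (+-suc l i) (bound (suc i) (s≤s i<w)))

sumFrom-periodic : ∀ f d → (∀ l → 1 ≤ l → f (l + d) ≡ f l) → ∀ l → 1 ≤ l → sumFrom f l d ≡ sumFrom f 1 d
sumFrom-periodic f d period (suc zero)    _ = refl
sumFrom-periodic f d period (suc (suc l)) _ =
  trans (+-cancelˡ-≡ (f (suc l)) _ _ shift) (sumFrom-periodic f d period (suc l) (s≤s z≤n))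
  where
  open ≡-Reasoning
  shift : f (suc l) + sumFrom f (suc (suc l)) d ≡ f (suc l) + sumFrom f (suc l) d
  shift = begin
    sumFrom f (suc l) (suc d)             ≡⟨ sumFrom-suc f (suc l) d ⟩
    sumFrom f (suc l) d + f (suc l + d)   ≡⟨ cong (sumFrom f (suc l) d +_) (period (suc l) (s≤s z≤n)) ⟩
    sumFrom f (suc l) d + f (suc l)       ≡⟨ +-comm _ (f (suc l)) ⟩
    f (suc l) + sumFrom f (suc l) d       ∎

sumFrom-blocks : ∀ f b d j l → (∀ i → i < j → sumFrom f (l + i * d) d ≤ b) → sumFrom f l (j * d) ≤ j * b
sumFrom-blocks f b d zero    l bound = z≤n
sumFrom-blocks f b d (suc j) l bound = begin
  sumFrom f l (d + j * d)                       ≡⟨ sumFrom-+ f l d (j * d) ⟩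
  sumFrom f l d + sumFrom f (l + d) (j * d)     ≤⟨ +-mono-≤ first rest ⟩
  b + j * b                                     ∎
  where
  open ≤-Reasoning
  first = subst (λ l′ → sumFrom f l′ d ≤ b) (+-identityʳ l) (bound 0 (s≤s z≤n))
  rest = sumFrom-blocks f b d j (l + d) λ i i<j →
    subst (λ l′ → sumFrom f l′ d ≤ b) (sym (+-assoc l d (i * d))) (bound (suc i) (s≤s i<j))

sumFrom-split-at : ∀ f l w₁ w₂ →
  sumFrom f l (suc w₁) + sumFrom f (l + w₁) (suc w₂) ≡ sumFrom f l (w₁ + suc w₂) + f (l + w₁)
sumFrom-split-at f l w₁ w₂ = begin
  sumFrom f l (suc w₁) + R                  ≡⟨ cong (_+ R) (sumFrom-suc f l w₁) ⟩
  sumFrom f l w₁ + f (l + w₁) + R           ≡⟨ +-assoc (sumFrom f l w₁) _ _ ⟩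
  sumFrom f l w₁ + (f (l + w₁) + R)         ≡⟨ cong (sumFrom f l w₁ +_) (+-comm (f (l + w₁)) R) ⟩
  sumFrom f l w₁ + (R + f (l + w₁))         ≡⟨ sym (+-assoc (sumFrom f l w₁) R _) ⟩
  sumFrom f l w₁ + R + f (l + w₁)           ≡⟨ cong (_+ f (l + w₁)) (sym (sumFrom-+ f l w₁ (suc w₂))) ⟩
  sumFrom f l (w₁ + suc w₂) + f (l + w₁)    ∎
  where
  open ≡-Reasoning
  R = sumFrom f (l + w₁) (suc w₂)

maxFrom : (ℕ → ℕ) → ℕ → ℕ → ℕ
maxFrom f l zero    = 0
maxFrom f l (suc w) = f l ⊔ maxFrom f (suc l) w

maxFrom-attained : ∀ f l w → 0 < w → ∃[ t ] (l ≤ t × t < l + w × f t ≡ maxFrom f l w)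
maxFrom-attained f l (suc zero)    _ = l , ≤-refl , m<m+n l (s≤s z≤n) , sym (⊔-identityʳ (f l))
maxFrom-attained f l (suc (suc w)) _
  with ⊔-sel (f l) (maxFrom f (suc l) (suc w)) | maxFrom-attained f (suc l) (suc w) (s≤s z≤n)
... | inj₁ atHead | _ = l , ≤-refl , m<m+n l (s≤s z≤n) , sym atHead
... | inj₂ inTail | t , l<t , t<l+w , ft =
  t , <⇒≤ l<t , subst (t <_) (sym (+-suc l (suc w))) t<l+w , trans ft (sym inTail)

≤-maxFrom : ∀ f l w i → i < w → f (l + i) ≤ maxFrom f l w
≤-maxFrom f l (suc w) zero    _ =
  subst (λ c → f c ≤ maxFrom f l (suc w)) (sym (+-identityʳ l)) (m≤m⊔n (f l) _)
≤-maxFrom f l (suc w) (suc i) (s≤s i<w) = ≤-trans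
  (subst (λ c → f c ≤ maxFrom f (suc l) w) (sym (+-suc l i)) (≤-maxFrom f (suc l) w i i<w)) (m≤n⊔m (f l) _)

maxFrom-monoʳ-≤ : ∀ f l {w w′} → w ≤ w′ → maxFrom f l w ≤ maxFrom f l w′
maxFrom-monoʳ-≤ f l {zero}  _         = z≤n
maxFrom-monoʳ-≤ f l {suc w} (s≤s w≤w′) = ⊔-monoʳ-≤ (f l) (maxFrom-monoʳ-≤ f (suc l) w≤w′)

sumFrom≤length*maxFrom : ∀ f l w → sumFrom f l w ≤ w * maxFrom f l w
sumFrom≤length*maxFrom f l w = sumFrom-≤-* f l w _ (≤-maxFrom f l w)

-- Walks and geodesics in P_n □ P_2

rowDist : ℕ → ℕ → ℕ
rowDist j j′ = 1 ∸ 𝟙 (j ≟ j′)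

rowDist-refl : ∀ j → rowDist j j ≡ 0
rowDist-refl j with j ≟ j
... | yes _   = refl
... | no j≢j = ⊥-elim (j≢j refl)

rowDist≤1 : ∀ j j′ → rowDist j j′ ≤ 1
rowDist≤1 j j′ with j ≟ j′
... | yes _ = z≤n
... | no _  = ≤-refl

rowDist-≢ : ∀ {j j′} → j ≢ j′ → rowDist j j′ ≡ 1
rowDist-≢ {j} {j′} j≢j′ with j ≟ j′
... | yes j≡j′ = ⊥-elim (j≢j′ j≡j′)
... | no _     = refl

rowDist-≡ : ∀ {j j′} → j ≡ j′ → rowDist j j′ ≡ 0
rowDist-≡ {j} refl = rowDist-refl j

dist : Vert → Vert → ℕ
dist (i , j) (i′ , j′) = ∣ i - i′ ∣ + rowDist j j′

∣m-n∣≤1+∣1+m-n∣ : ∀ m n → ∣ m - n ∣ ≤ suc ∣ suc m - n ∣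
∣m-n∣≤1+∣1+m-n∣ zero    zero    = z≤n
∣m-n∣≤1+∣1+m-n∣ zero    (suc n) = ≤-refl
∣m-n∣≤1+∣1+m-n∣ (suc m) zero    = ≤-trans (n≤1+n (suc m)) (n≤1+n (suc (suc m)))
∣m-n∣≤1+∣1+m-n∣ (suc m) (suc n) = ∣m-n∣≤1+∣1+m-n∣ m n

∣1+m-n∣≤1+∣m-n∣ : ∀ m n → ∣ suc m - n ∣ ≤ suc ∣ m - n ∣
∣1+m-n∣≤1+∣m-n∣ zero    zero    = ≤-refl
∣1+m-n∣≤1+∣m-n∣ zero    (suc n) = ≤-trans (n≤1+n n) (n≤1+n (suc n))
∣1+m-n∣≤1+∣m-n∣ (suc m) zero    = ≤-refl
∣1+m-n∣≤1+∣m-n∣ (suc m) (suc n) = ∣1+m-n∣≤1+∣m-n∣ m n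

1+∣1+m-n∣≡∣m-n∣⇒m<n : ∀ m n → suc ∣ suc m - n ∣ ≡ ∣ m - n ∣ → m < n
1+∣1+m-n∣≡∣m-n∣⇒m<n zero    (suc n) _  = s≤s z≤n
1+∣1+m-n∣≡∣m-n∣⇒m<n (suc m) zero    eq = ⊥-elim (1+n≰n (≤-trans (n≤1+n _) (≤-reflexive eq)))
1+∣1+m-n∣≡∣m-n∣⇒m<n (suc m) (suc n) eq = s≤s (1+∣1+m-n∣≡∣m-n∣⇒m<n m n eq)

1+∣m-n∣≡∣1+m-n∣⇒n≤m : ∀ m n → suc ∣ m - n ∣ ≡ ∣ suc m - n ∣ → n ≤ m
1+∣m-n∣≡∣1+m-n∣⇒n≤m m       zero    _  = z≤n
1+∣m-n∣≡∣1+m-n∣⇒n≤m zero    (suc n) eq = ⊥-elim (1+n≰n (≤-trans (≤-reflexive eq) (n≤1+n n)))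
1+∣m-n∣≡∣1+m-n∣⇒n≤m (suc m) (suc n) eq = s≤s (1+∣m-n∣≡∣1+m-n∣⇒n≤m m n eq)

Adj⇒dist≤1+dist : ∀ {u w} v → Adj u w → dist u v ≤ suc (dist w v)
Adj⇒dist≤1+dist {i , j} (i′ , j′) (inj₁ (refl , inj₁ refl)) = +-monoˡ-≤ (rowDist j j′) (∣m-n∣≤1+∣1+m-n∣ i i′)
Adj⇒dist≤1+dist {_ , j} (i′ , j′) (inj₁ (refl , inj₂ refl)) = +-monoˡ-≤ (rowDist j j′) (∣1+m-n∣≤1+∣m-n∣ _ i′)
Adj⇒dist≤1+dist {i , j} {_ , j₂} (i′ , j′) (inj₂ (refl , _)) = begin
  ∣ i - i′ ∣ + rowDist j j′               ≤⟨ +-monoʳ-≤ ∣ i - i′ ∣ (rowDist≤1 j j′) ⟩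
  ∣ i - i′ ∣ + 1                          ≡⟨ +-comm ∣ i - i′ ∣ 1 ⟩
  suc ∣ i - i′ ∣                          ≤⟨ s≤s (m≤m+n _ _) ⟩
  suc (∣ i - i′ ∣ + rowDist j₂ j′)        ∎
  where open ≤-Reasoning

module _ {n : ℕ} where

  Walk-length : ∀ {u v xs} → Walk n u v xs → length xs ≡ suc (λ-len xs)
  Walk-length (single _)   = refl
  Walk-length (step _ _ _) = refl

  dist≤λ-len : ∀ {u v xs} → Walk n u v xs → dist u v ≤ λ-len xs
  dist≤λ-len {i , j} (single _) = ≤-reflexive (cong₂ _+_ (∣n-n∣≡0 i) (rowDist-refl j))
  dist≤λ-len {v = v} (step _ adj walk) = ≤-trans (Adj⇒dist≤1+dist v adj)
    (subst (suc _ ≤_) (sym (Walk-length walk)) (s≤s (dist≤λ-len walk)))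

  Walk-source : ∀ {u v xs} → Walk n u v xs → InV n u
  Walk-source (single u∈V)   = u∈V
  Walk-source (step u∈V _ _) = u∈V

  Walk-target : ∀ {u v xs} → Walk n u v xs → InV n v
  Walk-target (single v∈V)    = v∈V
  Walk-target (step _ _ walk) = Walk-target walk

rowPath : ℕ → ℕ → ℕ → List Vert
rowPath j a zero    = (a , j) ∷ []
rowPath j a (suc w) = (a , j) ∷ rowPath j (suc a) w

rowPathDown : ℕ → ℕ → ℕ → List Vert
rowPathDown j a zero    = (a , j) ∷ []
rowPathDown j a (suc w) = (a + suc w , j) ∷ rowPathDown j a w

turnPath : ℕ → ℕ → ℕ → ℕ → ℕ → List Vert
turnPath j j′ a w₁ w₂ = rowPath j a w₁ ++ rowPath j′ (a + w₁) w₂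

InRow : ℕ → Set
InRow j = 1 ≤ j × j ≤ 2

length-rowPath : ∀ j a w → length (rowPath j a w) ≡ suc w
length-rowPath j a zero    = refl
length-rowPath j a (suc w) = cong suc (length-rowPath j (suc a) w)

length-rowPathDown : ∀ j a w → length (rowPathDown j a w) ≡ suc w
length-rowPathDown j a zero    = refl
length-rowPathDown j a (suc w) = cong suc (length-rowPathDown j a w)

λ-len-turnPath : ∀ j j′ a w₁ w₂ → λ-len (turnPath j j′ a w₁ w₂) ≡ suc (w₁ + w₂)
λ-len-turnPath j j′ a w₁ w₂ = begin
  length (rowPath j a w₁ ++ rowPath j′ (a + w₁) w₂) ∸ 1
    ≡⟨ cong (_∸ 1) (length-++ (rowPath j a w₁)) ⟩
  length (rowPath j a w₁) + length (rowPath j′ (a + w₁) w₂) ∸ 1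
    ≡⟨ cong₂ (λ x y → x + y ∸ 1) (length-rowPath j a w₁) (length-rowPath j′ (a + w₁) w₂) ⟩
  suc w₁ + suc w₂ ∸ 1
    ≡⟨ cong (_∸ 1) (+-suc (suc w₁) w₂) ⟩
  suc (w₁ + w₂) ∎
  where open ≡-Reasoning

module _ (n : ℕ) where

  rowPath-Walk : ∀ j a w → 1 ≤ a → a + w ≤ n → InRow j → Walk n (a , j) (a + w , j) (rowPath j a w)
  rowPath-Walk j a zero    1≤a a≤n j∈ = subst (λ b → Walk n (a , j) (b , j) ((a , j) ∷ [])) (sym (+-identityʳ a))
    (single ((1≤a , subst (_≤ n) (+-identityʳ a) a≤n) , j∈))
  rowPath-Walk j a (suc w) 1≤a a+w≤n j∈ = step ((1≤a , ≤-trans (m≤m+n a (suc w)) a+w≤n) , j∈) (inj₁ (refl , inj₁ refl))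
    (subst (λ b → Walk n (suc a , j) (b , j) (rowPath j (suc a) w)) (sym (+-suc a w))
      (rowPath-Walk j (suc a) w (s≤s z≤n) (subst (_≤ n) (+-suc a w) a+w≤n) j∈))

  rowPathDown-Walk : ∀ j a w → 1 ≤ a → a + w ≤ n → InRow j → Walk n (a + w , j) (a , j) (rowPathDown j a w)
  rowPathDown-Walk j a zero    1≤a a≤n j∈ = subst (λ b → Walk n (b , j) (a , j) ((a , j) ∷ [])) (sym (+-identityʳ a))
    (single ((1≤a , subst (_≤ n) (+-identityʳ a) a≤n) , j∈))
  rowPathDown-Walk j a (suc w) 1≤a a+w≤n j∈ =
    step ((≤-trans 1≤a (m≤m+n a (suc w)) , a+w≤n) , j∈) (inj₁ (refl , inj₂ (sym (+-suc a w))))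
      (rowPathDown-Walk j a w 1≤a (≤-trans (+-monoʳ-≤ a (n≤1+n w)) a+w≤n) j∈)

  rowPath-then-Walk : ∀ j j′ a w {v ys} → 1 ≤ a → a + w ≤ n → InRow j → j ≢ j′ →
    Walk n (a + w , j′) v ys → Walk n (a , j) v (rowPath j a w ++ ys)
  rowPath-then-Walk j j′ a zero    1≤a a≤n j∈ j≢j′ walk =
    step ((1≤a , subst (_≤ n) (+-identityʳ a) a≤n) , j∈) (inj₂ (sym (+-identityʳ a) , j≢j′)) walk
  rowPath-then-Walk j j′ a (suc w) {v} {ys} 1≤a a+w≤n j∈ j≢j′ walk =
    step ((1≤a , ≤-trans (m≤m+n a (suc w)) a+w≤n) , j∈) (inj₁ (refl , inj₁ refl))
      (rowPath-then-Walk j j′ (suc a) w (s≤s z≤n) (subst (_≤ n) (+-suc a w) a+w≤n) j∈ j≢j′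
        (subst (λ b → Walk n (b , j′) v ys) (+-suc a w) walk))

  turnPath-Walk : ∀ j j′ a w₁ w₂ → 1 ≤ a → a + w₁ + w₂ ≤ n → InRow j → InRow j′ → j ≢ j′ →
    Walk n (a , j) (a + w₁ + w₂ , j′) (turnPath j j′ a w₁ w₂)
  turnPath-Walk j j′ a w₁ w₂ 1≤a end≤n j∈ j′∈ j≢j′ =
    rowPath-then-Walk j j′ a w₁ 1≤a (≤-trans (m≤m+n (a + w₁) w₂) end≤n) j∈ j≢j′
      (rowPath-Walk j′ (a + w₁) w₂ (≤-trans 1≤a (m≤m+n a w₁)) end≤n j′∈)

  rowWalk : ∀ i i′ j → InV n (i , j) → InV n (i′ , j) → ∃[ xs ] (Walk n (i , j) (i′ , j) xs × λ-len xs ≤ ∣ i - i′ ∣)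
  rowWalk i i′ j ((1≤i , i≤n) , j∈) ((1≤i′ , i′≤n) , _) with i ≤? i′
  ... | yes i≤i′ = rowPath j i (i′ ∸ i) ,
    subst (λ b → Walk n (i , j) (b , j) (rowPath j i (i′ ∸ i))) (m+[n∸m]≡n i≤i′)
      (rowPath-Walk j i (i′ ∸ i) 1≤i (subst (_≤ n) (sym (m+[n∸m]≡n i≤i′)) i′≤n) j∈) ,
    ≤-reflexive (trans (cong (_∸ 1) (length-rowPath j i (i′ ∸ i))) (sym (m≤n⇒∣m-n∣≡n∸m i≤i′)))
  ... | no i≰i′ = rowPathDown j i′ (i ∸ i′) ,
    subst (λ b → Walk n (b , j) (i′ , j) (rowPathDown j i′ (i ∸ i′))) (m+[n∸m]≡n i′≤i)
      (rowPathDown-Walk j i′ (i ∸ i′) 1≤i′ (subst (_≤ n) (sym (m+[n∸m]≡n i′≤i)) i≤n) j∈) ,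
    ≤-reflexive (trans (cong (_∸ 1) (length-rowPathDown j i′ (i ∸ i′))) (sym (m≤n⇒∣n-m∣≡n∸m i′≤i)))
    where i′≤i = <⇒≤ (≰⇒> i≰i′)

  shortWalk : ∀ u v → InV n u → InV n v → ∃[ xs ] (Walk n u v xs × λ-len xs ≤ dist u v)
  shortWalk (i , j) (i′ , j′) u∈V v∈V with j ≟ j′
  ... | yes refl with rowWalk i i′ j u∈V v∈V
  ...   | xs , walk , short = xs , walk , ≤-trans short (m≤m+n _ _)
  shortWalk (i , j) (i′ , j′) (i∈ , j∈) (i′∈ , j′∈) | no j≢j′ with rowWalk i i′ j′ (i∈ , j′∈) (i′∈ , j′∈)
  ...   | xs , walk , short = (i , j) ∷ xs , step (i∈ , j∈) (inj₂ (refl , j≢j′)) walk ,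
    subst (_≤ ∣ i - i′ ∣ + 1) (sym (Walk-length walk)) (subst (suc (λ-len xs) ≤_) (+-comm 1 ∣ i - i′ ∣) (s≤s short))

  Geodesic⇒λ-len≤dist : ∀ {g} → (G : Geodesic n g) → λ-len g ≤ dist (proj₁ G) (proj₁ (proj₂ G))
  Geodesic⇒λ-len≤dist (u , v , walk , minimal) with shortWalk u v (Walk-source walk) (Walk-target walk)
  ... | xs , walk′ , short = ≤-trans (minimal xs walk′) short

rowPath-columns≥ : ∀ j a w → All (λ v → a ≤ proj₁ v) (rowPath j a w)
rowPath-columns≥ j a zero    = ≤-refl ∷ []
rowPath-columns≥ j a (suc w) = ≤-refl ∷ All.map <⇒≤ (rowPath-columns≥ j (suc a) w)

rowPath-rows : ∀ j a w → All (λ v → proj₂ v ≡ j) (rowPath j a w)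
rowPath-rows j a zero    = refl ∷ []
rowPath-rows j a (suc w) = refl ∷ rowPath-rows j (suc a) w

Unique-rowPath : ∀ j a w → Unique (rowPath j a w)
Unique-rowPath j a zero    = [] ∷ []
Unique-rowPath j a (suc w) =
  All.map (λ a<c a≡c → 1+n≰n (subst (suc a ≤_) (sym (cong proj₁ a≡c)) a<c)) (rowPath-columns≥ j (suc a) w)
    ∷ Unique-rowPath j (suc a) w

Unique-turnPath : ∀ j j′ a w₁ w₂ → j ≢ j′ → Unique (turnPath j j′ a w₁ w₂)
Unique-turnPath j j′ a w₁ w₂ j≢j′ = Unique.++⁺ (Unique-rowPath j a w₁) (Unique-rowPath j′ (a + w₁) w₂)
  λ (x∈₁ , x∈₂) → j≢j′ (trans (sym (All.lookup (rowPath-rows j a w₁) x∈₁)) (All.lookup (rowPath-rows j′ (a + w₁) w₂) x∈₂))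

turnPath-Geodesic : ∀ n j j′ a w₁ w₂ → 1 ≤ a → a + w₁ + w₂ ≤ n → InRow j → InRow j′ → j ≢ j′ →
  Geodesic n (turnPath j j′ a w₁ w₂)
turnPath-Geodesic n j j′ a w₁ w₂ 1≤a end≤n j∈ j′∈ j≢j′ =
  (a , j) , (a + w₁ + w₂ , j′) , turnPath-Walk n j j′ a w₁ w₂ 1≤a end≤n j∈ j′∈ j≢j′ , λ xs walk → begin
    λ-len (turnPath j j′ a w₁ w₂)
      ≡⟨ λ-len-turnPath j j′ a w₁ w₂ ⟩
    suc (w₁ + w₂)
      ≡⟨ +-comm 1 (w₁ + w₂) ⟩
    (w₁ + w₂) + 1
      ≡⟨ cong₂ _+_ (sym (trans (cong (∣ a -_∣) (+-assoc a w₁ w₂)) (∣m-m+n∣≡n a (w₁ + w₂)))) (sym (rowDist-≢ j≢j′)) ⟩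
    dist (a , j) (a + w₁ + w₂ , j′)
      ≤⟨ dist≤λ-len walk ⟩
    λ-len xs ∎
  where open ≤-Reasoning

Between : ℕ → ℕ → ℕ → Set
Between a c b = (a ≤ c × c ≤ b) ⊎ (b ≤ c × c ≤ a)

Between-refl : ∀ a b → Between a a b
Between-refl a b with ≤-total a b
... | inj₁ a≤b = inj₁ (≤-refl , a≤b)
... | inj₂ b≤a = inj₂ (b≤a , ≤-refl)

Between-sym : ∀ {a b c} → Between a c b → Between b c a
Between-sym (inj₁ p) = inj₂ p
Between-sym (inj₂ p) = inj₁ p

Between-trans : ∀ {a b c x} → Between a b c → Between b x c → Between a x c
Between-trans (inj₁ (a≤b , _)) (inj₁ (b≤x , x≤c)) = inj₁ (≤-trans a≤b b≤x , x≤c)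
Between-trans (inj₁ (a≤b , b≤c)) (inj₂ (c≤x , x≤b)) = inj₁ (≤-trans a≤b (≤-trans b≤c c≤x) , ≤-trans x≤b b≤c)
Between-trans (inj₂ (c≤b , b≤a)) (inj₁ (b≤x , x≤c)) = inj₂ (≤-trans c≤b b≤x , ≤-trans x≤c (≤-trans c≤b b≤a))
Between-trans (inj₂ (_ , b≤a)) (inj₂ (c≤x , x≤b)) = inj₂ (c≤x , ≤-trans x≤b b≤a)

Between-between : ∀ {a b c x} → Between a b c → Between b x c → Between a b x
Between-between (inj₁ (a≤b , _)) (inj₁ (b≤x , _))   = inj₁ (a≤b , b≤x)
Between-between (inj₁ (a≤b , b≤c)) (inj₂ (c≤x , x≤b)) = inj₁ (a≤b , ≤-trans b≤c c≤x)
Between-between (inj₂ (c≤b , b≤a)) (inj₁ (b≤x , x≤c)) = inj₂ (≤-trans x≤c c≤b , b≤a)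
Between-between (inj₂ (_ , b≤a)) (inj₂ (_ , x≤b))     = inj₂ (x≤b , b≤a)

Between⇒≤ : ∀ {a b c} → a ≤ b → Between a c b → a ≤ c × c ≤ b
Between⇒≤ a≤b (inj₁ p)           = p
Between⇒≤ a≤b (inj₂ (b≤c , c≤a)) = ≤-trans a≤b b≤c , ≤-trans c≤a a≤b

-- Possible vertex sets of a geodesic from (i , j) to (i′ , j′): a monotone row segment, or
-- a monotone segment of row j up to a turning column t followed by one of row j′.
RowShaped : ℕ → ℕ → ℕ → List Vert → Set
RowShaped j i i′ = All (λ v → proj₂ v ≡ j × Between i (proj₁ v) i′)

TurnShaped : ℕ → ℕ → ℕ → ℕ → List Vert → Set
TurnShaped j i j′ i′ g = ∃[ t ] (Between i t i′ ×
  All (λ v → (proj₂ v ≡ j × Between i (proj₁ v) t) ⊎ (proj₂ v ≡ j′ × Between t (proj₁ v) i′)) g)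

Shaped : Vert → Vert → List Vert → Set
Shaped (i , j) (i′ , j′) g = (j ≡ j′ → RowShaped j i i′ g) × (j ≢ j′ → TurnShaped j i j′ i′ g)

RowShaped-sym : ∀ {j i i′ g} → RowShaped j i i′ g → RowShaped j i′ i g
RowShaped-sym = All.map λ (row , between) → row , Between-sym between

TurnShaped-sym : ∀ {j i j′ i′ g} → TurnShaped j i j′ i′ g → TurnShaped j′ i′ j i g
TurnShaped-sym (t , between , vertices) = t , Between-sym between ,
  All.map (λ { (inj₁ (row , b)) → inj₂ (row , Between-sym b) ; (inj₂ (row , b)) → inj₁ (row , Between-sym b) }) vertices

Shaped-∷-horizontal : ∀ {i i₂ j i′ j′ xs} → Between i i₂ i′ → Shaped (i₂ , j) (i′ , j′) xs →
  Shaped (i , j) (i′ , j′) ((i , j) ∷ xs)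
Shaped-∷-horizontal {i} {i′ = i′} between (rowShaped , turnShaped) =
  (λ j≡j′ → (refl , Between-refl i i′) ∷ All.map (λ (row , b) → row , Between-trans between b) (rowShaped j≡j′)) ,
  (λ j≢j′ → let (t , bt , vertices) = turnShaped j≢j′ in
     t , Between-trans between bt , inj₁ (refl , Between-refl i t) ∷
     All.map (λ { (inj₁ (row , b)) → inj₁ (row , Between-trans (Between-between between bt) b) ; (inj₂ p) → inj₂ p }) vertices)

rowDist-tight : ∀ j₂ j j′ → suc (rowDist j₂ j′) ≡ rowDist j j′ → j₂ ≡ j′ × j ≢ j′
rowDist-tight j₂ j j′ eq with j₂ ≟ j′ | j ≟ j′ | eq
... | yes j₂≡j′ | no j≢j′ | _ = j₂≡j′ , j≢j′
... | yes _     | yes _   | ()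
... | no _      | yes _   | ()
... | no _      | no _    | ()

Shaped-∷-rung : ∀ {i j j₂ i′ j′ xs} → j₂ ≡ j′ → j ≢ j′ → Shaped (i , j₂) (i′ , j′) xs →
  Shaped (i , j) (i′ , j′) ((i , j) ∷ xs)
Shaped-∷-rung {i} {i′ = i′} j₂≡j′ j≢j′ (rowShaped , _) =
  (λ j≡j′ → ⊥-elim (j≢j′ j≡j′)) ,
  (λ _ → i , Between-refl i i′ , inj₁ (refl , Between-refl i i) ∷
     All.map (λ (row , b) → inj₂ (trans row j₂≡j′ , b)) (rowShaped j₂≡j′))

-- Along a walk of length dist u v every step decreases the distance to v, which fixes its direction.
Shaped-∷ : ∀ {u w v xs} → Adj u w → Shaped w v xs → suc (dist w v) ≡ dist u v → Shaped u v (u ∷ xs)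
Shaped-∷ {i , j} {_ , _} {i′ , j′} (inj₁ (refl , inj₁ refl)) shaped tight =
  Shaped-∷-horizontal (inj₁ (n≤1+n i , 1+∣1+m-n∣≡∣m-n∣⇒m<n i i′ (+-cancelʳ-≡ (rowDist j j′) _ _ tight))) shaped
Shaped-∷ {_ , j} {i₂ , _} {i′ , j′} (inj₁ (refl , inj₂ refl)) shaped tight =
  Shaped-∷-horizontal (inj₂ (1+∣m-n∣≡∣1+m-n∣⇒n≤m i₂ i′ (+-cancelʳ-≡ (rowDist j j′) _ _ tight) , n≤1+n i₂)) shaped
Shaped-∷ {i , j} {_ , j₂} {i′ , j′} (inj₂ (refl , _)) shaped tight =
  let (j₂≡j′ , j≢j′) = rowDist-tight j₂ j j′ (+-cancelˡ-≡ ∣ i - i′ ∣ _ _ (trans (+-suc ∣ i - i′ ∣ _) tight))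
  in Shaped-∷-rung j₂≡j′ j≢j′ shaped

Walk⇒Shaped : ∀ {n u v g} → Walk n u v g → λ-len g ≤ dist u v → Shaped u v g
Walk⇒Shaped {u = i , j} (single _) _ = (λ _ → (refl , Between-refl i i) ∷ []) , (λ j≢j → ⊥-elim (j≢j refl))
Walk⇒Shaped {u = u} {v} {_ ∷ xs} (step {w = w} _ adj walk) short =
  Shaped-∷ adj (Walk⇒Shaped walk short′) tight
  where
  short″ : suc (λ-len xs) ≤ dist u v
  short″ = subst (_≤ dist u v) (Walk-length walk) short
  short′ : λ-len xs ≤ dist w v
  short′ = ≤-pred (≤-trans short″ (Adj⇒dist≤1+dist v adj))
  tight : suc (dist w v) ≡ dist u v
  tight = ≤-antisym (≤-trans (s≤s (dist≤λ-len walk)) short″) (Adj⇒dist≤1+dist v adj)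

countIn≤count : ∀ {P : Vert → Set} (P? : Decidable P) {S g L} → Unique S → All P S →
  (∀ {x} → x ∈ g → x ∈ L) → countIn S g ≤ count P? L
countIn≤count P? {S} {g} uS S⊆P g⊆L = Unique-⊆⇒length≤ (Unique.filter⁺ (_∈? g) uS) λ x∈ →
  let (x∈S , x∈g) = ∈.∈-filter⁻ (_∈? g) {xs = S} x∈
  in ∈.∈-filter⁺ P? (g⊆L x∈g) (All.lookup S⊆P x∈S)

count≤countIn : ∀ S {g} → Unique g → count (_∈? S) g ≤ countIn S g
count≤countIn S {g} ug = Unique-⊆⇒length≤ (Unique.filter⁺ (_∈? S) ug) λ x∈ →
  let (x∈g , x∈S) = ∈.∈-filter⁻ (_∈? S) {xs = g} x∈ in ∈.∈-filter⁺ (_∈? g) x∈S x∈g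

[b∸a]+[c∸b]≡c∸a : ∀ {a b c} → a ≤ b → b ≤ c → (b ∸ a) + (c ∸ b) ≡ c ∸ a
[b∸a]+[c∸b]≡c∸a {a} {b} {c} a≤b b≤c = +-cancelˡ-≡ a _ _ (begin
  a + ((b ∸ a) + (c ∸ b))   ≡⟨ sym (+-assoc a _ _) ⟩
  a + (b ∸ a) + (c ∸ b)     ≡⟨ cong (_+ (c ∸ b)) (m+[n∸m]≡n a≤b) ⟩
  b + (c ∸ b)               ≡⟨ m+[n∸m]≡n b≤c ⟩
  c                         ≡⟨ sym (m+[n∸m]≡n (≤-trans a≤b b≤c)) ⟩
  a + (c ∸ a)               ∎)
  where open ≡-Reasoning

∈-rowPath : ∀ j a w {c} → a ≤ c → c ≤ a + w → (c , j) ∈ rowPath j a w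
∈-rowPath j a zero    a≤c c≤a = here (cong (_, j) (≤-antisym (subst (_ ≤_) (+-identityʳ a) c≤a) a≤c))
∈-rowPath j a (suc w) {c} a≤c c≤a+w with m≤n⇒m<n∨m≡n a≤c
... | inj₂ refl = here refl
... | inj₁ a<c  = there (∈-rowPath j (suc a) w a<c (subst (c ≤_) (+-suc a w) c≤a+w))

∈-rowPath-∸ : ∀ j {a b c} → a ≤ c → c ≤ b → (c , j) ∈ rowPath j a (b ∸ a)
∈-rowPath-∸ j a≤c c≤b = ∈-rowPath j _ _ a≤c (subst (_ ≤_) (sym (m+[n∸m]≡n (≤-trans a≤c c≤b))) c≤b)

RowShaped⊆rowPath : ∀ {j i i′ g} → i ≤ i′ → RowShaped j i i′ g → ∀ {x} → x ∈ g → x ∈ rowPath j i (i′ ∸ i)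
RowShaped⊆rowPath i≤i′ shaped x∈g with All.lookup shaped x∈g
... | refl , between = let (i≤c , c≤i′) = Between⇒≤ i≤i′ between in ∈-rowPath-∸ _ i≤c c≤i′

TurnShaped⊆turnPath : ∀ {j i j′ i′ t g} → i ≤ t → t ≤ i′ →
  All (λ v → (proj₂ v ≡ j × Between i (proj₁ v) t) ⊎ (proj₂ v ≡ j′ × Between t (proj₁ v) i′)) g →
  ∀ {x} → x ∈ g → x ∈ turnPath j j′ i (t ∸ i) (i′ ∸ t)
TurnShaped⊆turnPath {j} {i} {j′} {i′} {t} i≤t t≤i′ shaped x∈g with All.lookup shaped x∈g
... | inj₁ (refl , between) = let (i≤c , c≤t) = Between⇒≤ i≤t between in
  ∈.∈-++⁺ˡ (∈-rowPath-∸ j i≤c c≤t)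
... | inj₂ (refl , between) = let (t≤c , c≤i′) = Between⇒≤ t≤i′ between in
  ∈.∈-++⁺ʳ (rowPath j i (t ∸ i))
    (subst (λ a → _ ∈ rowPath j′ a (i′ ∸ t)) (sym (m+[n∸m]≡n i≤t)) (∈-rowPath-∸ j′ t≤c c≤i′))

module _ {P : Vert → Set} (P? : Decidable P) (d M : ℕ) where

  RowPathsBounded : Set
  RowPathsBounded = ∀ a w j → 1 ≤ a → w ≤ d → InRow j → count P? (rowPath j a w) ≤ M

  TurnPathsBounded : Set
  TurnPathsBounded = ∀ a w₁ w₂ j j′ → 1 ≤ a → suc (w₁ + w₂) ≤ d → InRow j → InRow j′ → j ≢ j′ →
    count P? (turnPath j j′ a w₁ w₂) ≤ M

GeodesicsBounded : ℕ → ℕ → ℕ → List Vert → Set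
GeodesicsBounded n d M S = ∀ g → Geodesic n g → λ-len g ≤ d → countIn S g ≤ M

module _ {P : Vert → Set} (P? : Decidable P) {d M : ℕ}
         (rowBound : RowPathsBounded P? d M) (turnBound : TurnPathsBounded P? d M)
         {S : List Vert} (uS : Unique S) (S⊆P : All P S) where

  RowShaped-bounded : ∀ {j i i′ g} → i ≤ i′ → 1 ≤ i → InRow j → ∣ i - i′ ∣ ≤ d → RowShaped j i i′ g → countIn S g ≤ M
  RowShaped-bounded {i = i} {i′} i≤i′ 1≤i j∈ short shaped =
    ≤-trans (countIn≤count P? uS S⊆P (RowShaped⊆rowPath i≤i′ shaped))
      (rowBound i (i′ ∸ i) _ 1≤i (subst (_≤ d) (m≤n⇒∣m-n∣≡n∸m i≤i′) short) j∈)

  TurnShaped-bounded : ∀ {j i j′ i′ g} → i ≤ i′ → 1 ≤ i → InRow j → InRow j′ → j ≢ j′ →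
    suc ∣ i - i′ ∣ ≤ d → TurnShaped j i j′ i′ g → countIn S g ≤ M
  TurnShaped-bounded {i = i} {i′ = i′} i≤i′ 1≤i j∈ j′∈ j≢j′ short (t , between , shaped) =
    let (i≤t , t≤i′) = Between⇒≤ i≤i′ between
        width = trans (m≤n⇒∣m-n∣≡n∸m i≤i′) (sym ([b∸a]+[c∸b]≡c∸a i≤t t≤i′))
    in ≤-trans (countIn≤count P? uS S⊆P (TurnShaped⊆turnPath i≤t t≤i′ shaped))
         (turnBound i (t ∸ i) (i′ ∸ t) _ _ 1≤i (subst (λ w → suc w ≤ d) width short) j∈ j′∈ j≢j′)

  geodesicsBounded : ∀ n → GeodesicsBounded n d M S
  geodesicsBounded n g G@((i , j) , (i′ , j′) , walk , _) short =
    bounded (Walk⇒Shaped walk (Geodesic⇒λ-len≤dist n G)) (j ≟ j′) (i ≤? i′)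
    where
    u∈V = Walk-source walk
    v∈V = Walk-target walk
    dist≤d : dist (i , j) (i′ , j′) ≤ d
    dist≤d = ≤-trans (dist≤λ-len walk) short
    row-dist≤d : j ≡ j′ → ∣ i - i′ ∣ ≤ d
    row-dist≤d j≡j′ = subst (_≤ d) (trans (cong (∣ i - i′ ∣ +_) (rowDist-≡ j≡j′)) (+-identityʳ _)) dist≤d
    turn-dist≤d : j ≢ j′ → suc ∣ i - i′ ∣ ≤ d
    turn-dist≤d j≢j′ = subst (_≤ d) (trans (cong (∣ i - i′ ∣ +_) (rowDist-≢ j≢j′)) (+-comm _ 1)) dist≤d
    bounded : Shaped (i , j) (i′ , j′) g → Dec (j ≡ j′) → Dec (i ≤ i′) → countIn S g ≤ M
    bounded (rowShaped , _) (yes j≡j′) (yes i≤i′) =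
      RowShaped-bounded i≤i′ (proj₁ (proj₁ u∈V)) (proj₂ u∈V) (row-dist≤d j≡j′) (rowShaped j≡j′)
    bounded (rowShaped , _) (yes j≡j′) (no i≰i′) =
      RowShaped-bounded (<⇒≤ (≰⇒> i≰i′)) (proj₁ (proj₁ v∈V)) (proj₂ u∈V)
        (subst (_≤ d) (∣-∣-comm i i′) (row-dist≤d j≡j′)) (RowShaped-sym (rowShaped j≡j′))
    bounded (_ , turnShaped) (no j≢j′) (yes i≤i′) =
      TurnShaped-bounded i≤i′ (proj₁ (proj₁ u∈V)) (proj₂ u∈V) (proj₂ v∈V) j≢j′ (turn-dist≤d j≢j′) (turnShaped j≢j′)
    bounded (_ , turnShaped) (no j≢j′) (no i≰i′) =
      TurnShaped-bounded (<⇒≤ (≰⇒> i≰i′)) (proj₁ (proj₁ v∈V)) (proj₂ v∈V) (proj₂ u∈V) (j≢j′ ∘ sym)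
        (subst (λ x → suc x ≤ d) (∣-∣-comm i i′) (turn-dist≤d j≢j′)) (TurnShaped-sym (turnShaped j≢j′))

-- Columns marked in blocks of d

𝟙-sound : ∀ {P : Set} {P? : Dec P} → 𝟙 P? ≡ 1 → P
𝟙-sound {P? = yes p} _ = p

𝟙-complete : ∀ {P : Set} (P? : Dec P) → P → 𝟙 P? ≡ 1
𝟙-complete (yes _) _ = refl
𝟙-complete (no ¬p) p = contradiction p ¬p

𝟙[≟1] : ∀ a → a ≤ 1 → 𝟙 (a ≟ 1) ≡ a
𝟙[≟1] zero          _ = refl
𝟙[≟1] (suc zero)    _ = refl
𝟙[≟1] (suc (suc a)) (s≤s ())

marked : ∀ {P : Vert → Set} → Decidable P → ℕ → ℕ → ℕ
marked P? j c = 𝟙 (P? (c , j))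

count-rowPath : ∀ {P : Vert → Set} (P? : Decidable P) j a w →
  count P? (rowPath j a w) ≡ sumFrom (marked P? j) a (suc w)
count-rowPath P? j a zero    = count-∷ P? (a , j) []
count-rowPath P? j a (suc w) = trans (count-∷ P? (a , j) _) (cong (𝟙 (P? (a , j)) +_) (count-rowPath P? j (suc a) w))

count-turnPath : ∀ {P : Vert → Set} (P? : Decidable P) j j′ a w₁ w₂ → count P? (turnPath j j′ a w₁ w₂) ≡
  sumFrom (marked P? j) a (suc w₁) + sumFrom (marked P? j′) (a + w₁) (suc w₂)
count-turnPath P? j j′ a w₁ w₂ = trans (count-++ P? (rowPath j a w₁) _)
  (cong₂ _+_ (count-rowPath P? j a w₁) (count-rowPath P? j′ (a + w₁) w₂))

sumFrom-𝟙[<]≡⊓ : ∀ K w → sumFrom (λ c → 𝟙 (c ∸ 1 <? K)) 1 w ≡ w ⊓ K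
sumFrom-𝟙[<]≡⊓ K zero    = refl
sumFrom-𝟙[<]≡⊓ K (suc w) = trans (sumFrom-suc _ 1 w) (trans (cong (_+ 𝟙 (w <? K)) (sumFrom-𝟙[<]≡⊓ K w)) (add-next (w <? K)))
  where
  add-next : (w<K : Dec (w < K)) → w ⊓ K + 𝟙 w<K ≡ suc w ⊓ K
  add-next (yes w<K) = trans (+-comm (w ⊓ K) 1) (trans (cong suc (m≤n⇒m⊓n≡m (<⇒≤ w<K))) (sym (m≤n⇒m⊓n≡m w<K)))
  add-next (no w≮K)  = trans (+-identityʳ _) (trans (m≥n⇒m⊓n≡n (≮⇒≥ w≮K)) (sym (m≥n⇒m⊓n≡n (m≤n⇒m≤1+n (≮⇒≥ w≮K)))))

module Blocks (d : ℕ) .{{_ : NonZero d}} where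

  -- With columns grouped into the blocks [ds + 1, ds + d], blockPrefix K marks the first K columns of
  -- each block: B_{k,d} occupies the columns marked by blockPrefix (k - 2), A_{k,d} those marked by
  -- blockPrefix (2k - 3).
  blockPrefix : ℕ → ℕ → ℕ
  blockPrefix K c = 𝟙 ((c ∸ 1) % d <? K)

  blockPrefix≤1 : ∀ K c → blockPrefix K c ≤ 1
  blockPrefix≤1 K c = 𝟙≤1 _

  blockPrefix-periodic : ∀ K l → 1 ≤ l → blockPrefix K (l + d) ≡ blockPrefix K l
  blockPrefix-periodic K (suc l) _ = cong (λ r → 𝟙 (r <? K)) ([m+n]%n≡m%n l d)

  sumFrom-blockPrefix-aligned : ∀ K j w → w ≤ d → sumFrom (blockPrefix K) (j * d + 1) w ≡ w ⊓ K
  sumFrom-blockPrefix-aligned K j w w≤d =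
    trans (sumFrom-cong (blockPrefix K) (λ c → 𝟙 (c ∸ 1 <? K)) (j * d + 1) 1 w offset) (sumFrom-𝟙[<]≡⊓ K w)
    where
    offset : ∀ i → i < w → blockPrefix K (j * d + 1 + i) ≡ 𝟙 (i <? K)
    offset i i<w = cong (λ r → 𝟙 (r <? K)) (begin
      (j * d + 1 + i ∸ 1) % d  ≡⟨ cong (λ c → (c ∸ 1) % d) (trans (cong (_+ i) (+-comm (j * d) 1)) (cong suc (+-comm (j * d) i))) ⟩
      (i + j * d) % d          ≡⟨ [m+kn]%n≡m%n i j d ⟩
      i % d                    ≡⟨ m<n⇒m%n≡m (≤-trans i<w w≤d) ⟩
      i                        ∎)
      where open ≡-Reasoning

  sumFrom-blockPrefix-period : ∀ K l → 1 ≤ l → sumFrom (blockPrefix K) l d ≡ d ⊓ K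
  sumFrom-blockPrefix-period K l 1≤l =
    trans (sumFrom-periodic (blockPrefix K) d (blockPrefix-periodic K) l 1≤l) (sumFrom-blockPrefix-aligned K 0 d ≤-refl)

  sumFrom-blockPrefix : ∀ K q j r → r ≤ d → sumFrom (blockPrefix K) (j * d + 1) (q * d + r) ≡ q * (d ⊓ K) + r ⊓ K
  sumFrom-blockPrefix K zero    j r r≤d = sumFrom-blockPrefix-aligned K j r r≤d
  sumFrom-blockPrefix K (suc q) j r r≤d = begin
    sumFrom (blockPrefix K) (j * d + 1) (d + q * d + r)
      ≡⟨ cong (sumFrom (blockPrefix K) (j * d + 1)) (+-assoc d (q * d) r) ⟩
    sumFrom (blockPrefix K) (j * d + 1) (d + (q * d + r))
      ≡⟨ sumFrom-+ (blockPrefix K) (j * d + 1) d (q * d + r) ⟩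
    sumFrom (blockPrefix K) (j * d + 1) d + sumFrom (blockPrefix K) (j * d + 1 + d) (q * d + r)
      ≡⟨ cong₂ _+_ (sumFrom-blockPrefix-aligned K j d ≤-refl) (cong (λ l → sumFrom (blockPrefix K) l (q * d + r)) nextBlock) ⟩
    d ⊓ K + sumFrom (blockPrefix K) (suc j * d + 1) (q * d + r)
      ≡⟨ cong (d ⊓ K +_) (sumFrom-blockPrefix K q (suc j) r r≤d) ⟩
    d ⊓ K + (q * (d ⊓ K) + r ⊓ K)
      ≡⟨ sym (+-assoc (d ⊓ K) _ _) ⟩
    suc q * (d ⊓ K) + r ⊓ K ∎
    where
    open ≡-Reasoning
    nextBlock : j * d + 1 + d ≡ suc j * d + 1
    nextBlock = trans (+-assoc (j * d) 1 d) (trans (cong (j * d +_) (+-comm 1 d))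
      (trans (sym (+-assoc (j * d) d 1)) (cong (_+ 1) (+-comm (j * d) d))))

  sumFrom-blockPrefix≤ : ∀ K l w → 1 ≤ l → w ≤ d → sumFrom (blockPrefix K) l w ≤ d ⊓ K
  sumFrom-blockPrefix≤ K l w 1≤l w≤d =
    subst (sumFrom (blockPrefix K) l w ≤_) (sumFrom-blockPrefix-period K l 1≤l) (sumFrom-monoʳ-≤ (blockPrefix K) l w≤d)

  sumFrom-blockPrefix≤1+ : ∀ K l w → 1 ≤ l → w ≤ d → sumFrom (blockPrefix K) l (suc w) ≤ suc (d ⊓ K)
  sumFrom-blockPrefix≤1+ K l w 1≤l w≤d = begin
    sumFrom (blockPrefix K) l (suc w)
      ≤⟨ sumFrom-monoʳ-≤ (blockPrefix K) l (s≤s w≤d) ⟩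
    sumFrom (blockPrefix K) l (suc d)
      ≡⟨ sumFrom-suc (blockPrefix K) l d ⟩
    sumFrom (blockPrefix K) l d + blockPrefix K (l + d)
      ≤⟨ +-mono-≤ (≤-reflexive (sumFrom-blockPrefix-period K l 1≤l)) (blockPrefix≤1 K (l + d)) ⟩
    d ⊓ K + 1
      ≡⟨ +-comm _ 1 ⟩
    suc (d ⊓ K) ∎
    where open ≤-Reasoning

  [r+s*d]%d≡r : ∀ {r} s → r < d → (r + s * d) % d ≡ r
  [r+s*d]%d≡r {r} s r<d = trans ([m+kn]%n≡m%n r s d) (m<n⇒m%n≡m r<d)

  [r+s*d]/d≡s : ∀ {r} s → r < d → (r + s * d) / d ≡ s
  [r+s*d]/d≡s {r} s r<d = trans (+-distrib-/-∣ʳ r (n∣m*n s)) (cong₂ _+_ (m<n⇒m/n≡0 r<d) (m*n/n≡m s d))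

  inBlock⇒ : ∀ {i s L} → L ≤ d → d * s + 1 ≤ i → i ≤ d * s + L → (i ∸ 1) % d < L × (i ∸ 1) / d ≡ s
  inBlock⇒ {zero}  {s} _   lo _  = contradiction lo (<⇒≱ (m≤n+m 1 (d * s)))
  inBlock⇒ {suc i} {s} {L} L≤d lo hi =
    subst (_< L) (sym (trans (cong (_% d) i≡r+s*d) ([r+s*d]%d≡r s r<d))) r<L ,
    trans (cong (_/ d) i≡r+s*d) ([r+s*d]/d≡s s r<d)
    where
    ds≤i : d * s ≤ i
    ds≤i = ≤-pred (subst (_≤ suc i) (+-comm (d * s) 1) lo)
    r = i ∸ d * s
    i≡r+s*d : i ≡ r + s * d
    i≡r+s*d = trans (sym (m∸n+n≡m ds≤i)) (cong (r +_) (*-comm d s))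
    r<L : r < L
    r<L = +-cancelˡ-< (d * s) _ _ (subst (_< d * s + L) (sym (m+[n∸m]≡n ds≤i)) hi)
    r<d = ≤-trans r<L L≤d

  ⇒inBlock : ∀ {i L} → 1 ≤ i → (i ∸ 1) % d < L → d * ((i ∸ 1) / d) + 1 ≤ i × i ≤ d * ((i ∸ 1) / d) + L
  ⇒inBlock {suc i} {L} _ i%d<L =
    subst (_≤ suc i) (+-comm 1 (d * s)) (s≤s (subst (d * s ≤_) (sym i≡i%d+d*s) (m≤n+m (d * s) (i % d)))) ,
    subst (_≤ d * s + L) (cong suc (sym i≡i%d+d*s)) (subst (suc (i % d + d * s) ≤_) (+-comm L (d * s)) (+-monoˡ-≤ (d * s) i%d<L))
    where
    s = i / d
    i≡i%d+d*s : i ≡ i % d + d * s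
    i≡i%d+d*s = trans (m≡m%n+[m/n]*n i d) (cong (i % d +_) (*-comm s d))

vertices : ℕ → List Vert
vertices zero    = []
vertices (suc n) = (suc n , 1) ∷ (suc n , 2) ∷ vertices n

∈-vertices : ∀ n {v} → InV n v → v ∈ vertices n
∈-vertices zero    ((1≤i , i≤0) , _) = ⊥-elim (1+n≰n (≤-trans 1≤i i≤0))
∈-vertices (suc n) {i , j} ((1≤i , i≤1+n) , (1≤j , j≤2)) with m≤n⇒m<n∨m≡n i≤1+n | m≤n⇒m<n∨m≡n j≤2
... | inj₁ i<1+n  | _              = there (there (∈-vertices n ((1≤i , ≤-pred i<1+n) , (1≤j , j≤2))))
... | inj₂ refl   | inj₂ refl      = there (here refl)
... | inj₂ refl   | inj₁ (s≤s j≤1) = here (cong (suc n ,_) (≤-antisym j≤1 1≤j))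

vertices-InV : ∀ n {v} → v ∈ vertices n → InV n v
vertices-InV (suc n) (here refl)         = (s≤s z≤n , ≤-refl) , (≤-refl , s≤s z≤n)
vertices-InV (suc n) (there (here refl)) = (s≤s z≤n , ≤-refl) , (s≤s z≤n , ≤-refl)
vertices-InV (suc n) (there (there v∈)) =
  let ((1≤i , i≤n) , j∈) = vertices-InV n v∈ in (1≤i , m≤n⇒m≤1+n i≤n) , j∈

Unique-vertices : ∀ n → Unique (vertices n)
Unique-vertices zero    = []
Unique-vertices (suc n) = ((λ ()) ∷ newColumn) ∷ newColumn ∷ Unique-vertices n
  where
  newColumn : ∀ {j} → All ((suc n , j) ≢_) (vertices n)
  newColumn = All.tabulate λ v∈ eq → 1+n≰n (subst (_≤ n) (sym (cong proj₁ eq)) (proj₂ (proj₁ (vertices-InV n v∈))))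

count-vertices : ∀ {P : Vert → Set} (P? : Decidable P) n →
  count P? (vertices n) ≡ sumFrom (λ c → marked P? 1 c + marked P? 2 c) 1 n
count-vertices P? zero    = refl
count-vertices P? (suc n) = begin
  count P? ((suc n , 1) ∷ (suc n , 2) ∷ vertices n)                    ≡⟨ count-∷ P? _ _ ⟩
  marked P? 1 (suc n) + count P? ((suc n , 2) ∷ vertices n)            ≡⟨ cong (marked P? 1 (suc n) +_) (count-∷ P? _ _) ⟩
  marked P? 1 (suc n) + (marked P? 2 (suc n) + count P? (vertices n))  ≡⟨ sym (+-assoc (marked P? 1 (suc n)) _ _) ⟩
  column + count P? (vertices n)                                       ≡⟨ cong (column +_) (count-vertices P? n) ⟩
  column + sumFrom _ 1 n                                               ≡⟨ +-comm column _ ⟩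
  sumFrom _ 1 n + column                                               ≡⟨ sym (sumFrom-suc _ 1 n) ⟩
  sumFrom (λ c → marked P? 1 c + marked P? 2 c) 1 (suc n)              ∎
  where
  open ≡-Reasoning
  column = marked P? 1 (suc n) + marked P? 2 (suc n)

Card⇒≡count : ∀ {Q P : Vert → Set} (P? : Decidable P) n {b} → Card Q b →
  (∀ v → Q v → P v × InV n v) → (∀ v → P v → InV n v → Q v) → b ≡ count P? (vertices n)
Card⇒≡count P? n (xs , uxs , xs↔Q , refl) Q⇒P P⇒Q = ≤-antisym
  (Unique-⊆⇒length≤ uxs λ {x} x∈xs →
    let (px , x∈V) = Q⇒P x (Equivalence.to (xs↔Q x) x∈xs) in ∈.∈-filter⁺ P? (∈-vertices n x∈V) px)
  (Unique-⊆⇒length≤ (Unique.filter⁺ P? (Unique-vertices n)) λ {x} x∈ →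
    let (x∈V , px) = ∈.∈-filter⁻ P? {xs = vertices n} x∈ in Equivalence.from (xs↔Q x) (P⇒Q x px (vertices-InV n x∈V)))

IsVSet-filter-vertices : ∀ {P : Vert → Set} (P? : Decidable P) n → IsVSet n (filter P? (vertices n))
IsVSet-filter-vertices P? n = Unique.filter⁺ P? (Unique-vertices n) ,
  All.tabulate λ x∈ → vertices-InV n (proj₁ (∈.∈-filter⁻ P? {xs = vertices n} x∈))

All-filter : ∀ {P : Vert → Set} (P? : Decidable P) xs → All P (filter P? xs)
All-filter P? xs = All.tabulate λ x∈ → proj₂ (∈.∈-filter⁻ P? {xs = xs} x∈)

GeodesicsBounded⇒IsGenPos : ∀ {n d m S} → IsVSet n S → GeodesicsBounded n d (suc m) S → IsGenPos n (suc (suc m)) d S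
GeodesicsBounded⇒IsGenPos vset bounded = vset , λ g G crowded → ≰⇒> λ short → 1+n≰n (≤-trans crowded (bounded g G short))

IsGenPos⇒GeodesicsBounded : ∀ {n d m S} → IsGenPos n (suc (suc m)) d S → GeodesicsBounded n d (suc m) S
IsGenPos⇒GeodesicsBounded (_ , sparse) g G short = ≮⇒≥ λ crowded → <⇒≱ (sparse g G crowded) short

pathsBounded⇒genPosSet : ∀ {P : Vert → Set} (P? : Decidable P) {n d m} → RowPathsBounded P? d (suc m) → TurnPathsBounded P? d (suc m) →
  ∃[ S ] (IsGenPos n (suc (suc m)) d S × length S ≡ count P? (vertices n))
pathsBounded⇒genPosSet P? {n} rows turns = filter P? (vertices n) ,
  GeodesicsBounded⇒IsGenPos (IsVSet-filter-vertices P? n)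
    (geodesicsBounded P? rows turns (proj₁ (IsVSet-filter-vertices P? n)) (All-filter P? (vertices n)) n) ,
  refl

-- The set B_{k,d}

module BColumns (d : ℕ) .{{_ : NonZero d}} (m : ℕ) (m≤d : m ≤ d) where
  open Blocks d

  InBCol : Vert → Set
  InBCol (c , _) = blockPrefix m c ≡ 1

  InBCol? : Decidable InBCol
  InBCol? (c , _) = blockPrefix m c ≟ 1

  marked-InBCol : ∀ j c → marked InBCol? j c ≡ blockPrefix m c
  marked-InBCol j c = 𝟙[≟1] (blockPrefix m c) (blockPrefix≤1 m c)

  sumFrom-marked-InBCol : ∀ j l w → sumFrom (marked InBCol? j) l w ≡ sumFrom (blockPrefix m) l w
  sumFrom-marked-InBCol j l w = sumFrom-cong _ _ l l w (λ i _ → marked-InBCol j (l + i))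

  d⊓m≡m : d ⊓ m ≡ m
  d⊓m≡m = m≥n⇒m⊓n≡n m≤d

  rowPathsBounded : RowPathsBounded InBCol? d (suc m)
  rowPathsBounded l w j 1≤l w≤d _ = begin
    count InBCol? (rowPath j l w)      ≡⟨ count-rowPath InBCol? j l w ⟩
    sumFrom (marked InBCol? j) l (suc w) ≡⟨ sumFrom-marked-InBCol j l (suc w) ⟩
    sumFrom (blockPrefix m) l (suc w)  ≤⟨ sumFrom-blockPrefix≤1+ m l w 1≤l w≤d ⟩
    suc (d ⊓ m)                        ≡⟨ cong suc d⊓m≡m ⟩
    suc m                              ∎
    where open ≤-Reasoning

  -- The turning column is counted twice, and the rest lies in a window of at most d columns.
  turnPathsBounded : TurnPathsBounded InBCol? d (suc m)
  turnPathsBounded l w₁ w₂ j j′ 1≤l w≤d _ _ _ = begin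
    count InBCol? (turnPath j j′ l w₁ w₂)
      ≡⟨ count-turnPath InBCol? j j′ l w₁ w₂ ⟩
    sumFrom (marked InBCol? j) l (suc w₁) + sumFrom (marked InBCol? j′) (l + w₁) (suc w₂)
      ≡⟨ cong₂ _+_ (sumFrom-marked-InBCol j l (suc w₁)) (sumFrom-marked-InBCol j′ (l + w₁) (suc w₂)) ⟩
    sumFrom (blockPrefix m) l (suc w₁) + sumFrom (blockPrefix m) (l + w₁) (suc w₂)
      ≡⟨ sumFrom-split-at (blockPrefix m) l w₁ w₂ ⟩
    sumFrom (blockPrefix m) l (w₁ + suc w₂) + blockPrefix m (l + w₁)
      ≤⟨ +-mono-≤ (sumFrom-blockPrefix≤ m l (w₁ + suc w₂) 1≤l (subst (_≤ d) (sym (+-suc w₁ w₂)) w≤d))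
                  (blockPrefix≤1 m (l + w₁)) ⟩
    d ⊓ m + 1
      ≡⟨ trans (cong (_+ 1) d⊓m≡m) (+-comm m 1) ⟩
    suc m ∎
    where open ≤-Reasoning

  count-vertices-InBCol : ∀ n → count InBCol? (vertices n) ≡ sumFrom (blockPrefix m) 1 n + sumFrom (blockPrefix m) 1 n
  count-vertices-InBCol n = trans (count-vertices InBCol? n)
    (trans (sumFrom-cong _ (λ c → blockPrefix m c + blockPrefix m c) 1 1 n
              λ i _ → cong₂ _+_ (marked-InBCol 1 (suc i)) (marked-InBCol 2 (suc i)))
      (sumFrom-+-distrib (blockPrefix m) (blockPrefix m) 1 n))

  card-B : ∀ n {b} → Card (λ x → InB (suc (suc m)) d x × InV n x) b →
    b ≡ sumFrom (blockPrefix m) 1 n + sumFrom (blockPrefix m) 1 n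
  card-B n card = trans (Card⇒≡count InBCol? n card InB⇒ ⇒InB) (count-vertices-InBCol n)
    where
    InB⇒ : ∀ v → InB (suc (suc m)) d v × InV n v → InBCol v × InV n v
    InB⇒ (i , j) ((s , (lo , hi) , _) , v∈V) = 𝟙-complete _ (proj₁ (inBlock⇒ m≤d lo hi)) , v∈V
    ⇒InB : ∀ v → InBCol v → InV n v → InB (suc (suc m)) d v × InV n v
    ⇒InB (i , j) inBCol v∈V@((1≤i , _) , j∈) = ((i ∸ 1) / d , ⇒inBlock 1≤i (𝟙-sound inBCol) , j∈) , v∈V

  B-witness : ∀ n → ∃[ S ] (IsGenPos n (suc (suc m)) d S × length S ≡ sumFrom (blockPrefix m) 1 n + sumFrom (blockPrefix m) 1 n)
  B-witness n with pathsBounded⇒genPosSet InBCol? {n} rowPathsBounded turnPathsBounded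
  ... | S , genPos , length≡ = S , genPos , trans length≡ (count-vertices-InBCol n)

-- The set A_{k,d} and its alternating variant

module OneRowPerColumn (col row : ℕ → ℕ) (col≤1 : ∀ c → col c ≤ 1) (row-InRow : ∀ c → InRow (row c)) where

  OnRow : Vert → Set
  OnRow (c , r) = col c ≡ 1 × r ≡ row c

  OnRow? : Decidable OnRow
  OnRow? (c , r) = (col c ≟ 1) ×-dec (r ≟ row c)

  marked-OnRow : ∀ j c → marked OnRow? j c ≡ col c * 𝟙 (j ≟ row c)
  marked-OnRow j c = trans (𝟙-×-dec (col c ≟ 1) (j ≟ row c)) (cong (_* 𝟙 (j ≟ row c)) (𝟙[≟1] (col c) (col≤1 c)))

  marked-OnRow-column : ∀ c → marked OnRow? 1 c + marked OnRow? 2 c ≡ col c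
  marked-OnRow-column c = begin
    marked OnRow? 1 c + marked OnRow? 2 c         ≡⟨ cong₂ _+_ (marked-OnRow 1 c) (marked-OnRow 2 c) ⟩
    col c * 𝟙 (1 ≟ row c) + col c * 𝟙 (2 ≟ row c)  ≡⟨ sym (*-distribˡ-+ (col c) _ _) ⟩
    col c * (𝟙 (1 ≟ row c) + 𝟙 (2 ≟ row c))        ≡⟨ cong (col c *_) (oneRow (row c) (row-InRow c)) ⟩
    col c * 1                                      ≡⟨ *-identityʳ (col c) ⟩
    col c                                          ∎
    where
    open ≡-Reasoning
    oneRow : ∀ r → InRow r → 𝟙 (1 ≟ r) + 𝟙 (2 ≟ r) ≡ 1
    oneRow 1 _ = refl
    oneRow 2 _ = refl
    oneRow (suc (suc (suc _))) (_ , s≤s (s≤s ()))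

  count-vertices-OnRow : ∀ n → count OnRow? (vertices n) ≡ sumFrom col 1 n
  count-vertices-OnRow n = trans (count-vertices OnRow? n) (sumFrom-cong _ col 1 1 n λ i _ → marked-OnRow-column (suc i))

-- The vertex set used for A_{k,d} has the same columns as A_{k,d}, and its t-th column carries the
-- vertex in row rowOfRank t; so of its first x vertices, ⌈ x /2⌉ lie in row 1 and ⌊ x /2⌋ in row 2.
rowOfRank : ℕ → ℕ
rowOfRank zero          = 2
rowOfRank (suc zero)    = 1
rowOfRank (suc (suc t)) = rowOfRank t

rowOfRank-InRow : ∀ t → InRow (rowOfRank t)
rowOfRank-InRow zero          = s≤s z≤n , ≤-refl
rowOfRank-InRow (suc zero)    = ≤-refl , s≤s z≤n
rowOfRank-InRow (suc (suc t)) = rowOfRank-InRow t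

⌊m+2n/2⌋≡⌊m/2⌋+n : ∀ m n → ⌊ m + 2 * n /2⌋ ≡ ⌊ m /2⌋ + n
⌊m+2n/2⌋≡⌊m/2⌋+n m zero    = trans (cong ⌊_/2⌋ (+-identityʳ m)) (sym (+-identityʳ _))
⌊m+2n/2⌋≡⌊m/2⌋+n m (suc n) = begin
  ⌊ m + 2 * suc n /2⌋        ≡⟨ cong ⌊_/2⌋ (m+2[1+n]≡2+[m+2n] m n) ⟩
  suc ⌊ m + 2 * n /2⌋        ≡⟨ cong suc (⌊m+2n/2⌋≡⌊m/2⌋+n m n) ⟩
  suc (⌊ m /2⌋ + n)          ≡⟨ sym (+-suc ⌊ m /2⌋ n) ⟩
  ⌊ m /2⌋ + suc n            ∎
  where
  open ≡-Reasoning
  m+2[1+n]≡2+[m+2n] : ∀ m n → m + 2 * suc n ≡ suc (suc (m + 2 * n))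
  m+2[1+n]≡2+[m+2n] = solve-∀

⌈m+2n/2⌉≡⌈m/2⌉+n : ∀ m n → ⌈ m + 2 * n /2⌉ ≡ ⌈ m /2⌉ + n
⌈m+2n/2⌉≡⌈m/2⌉+n m = ⌊m+2n/2⌋≡⌊m/2⌋+n (suc m)

⌈x/2⌉+row1 : ∀ x a → a ≤ 1 → ⌈ x /2⌉ + a * 𝟙 (1 ≟ rowOfRank (x + a)) ≡ ⌈ x + a /2⌉
⌈x/2⌉+row1 x zero    _ = trans (+-identityʳ _) (cong ⌈_/2⌉ (sym (+-identityʳ x)))
⌈x/2⌉+row1 x (suc (suc a)) (s≤s ())
⌈x/2⌉+row1 x (suc zero) _ = trans (cong (λ y → ⌈ x /2⌉ + (𝟙 (1 ≟ rowOfRank y) + 0)) (+-comm x 1))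
  (trans (next x) (cong ⌈_/2⌉ (+-comm 1 x)))
  where
  next : ∀ x → ⌈ x /2⌉ + (𝟙 (1 ≟ rowOfRank (suc x)) + 0) ≡ ⌈ suc x /2⌉
  next zero          = refl
  next (suc zero)    = refl
  next (suc (suc x)) = cong suc (next x)

⌊x/2⌋+row2 : ∀ x a → a ≤ 1 → ⌊ x /2⌋ + a * 𝟙 (2 ≟ rowOfRank (x + a)) ≡ ⌊ x + a /2⌋
⌊x/2⌋+row2 x zero    _ = trans (+-identityʳ _) (cong ⌊_/2⌋ (sym (+-identityʳ x)))
⌊x/2⌋+row2 x (suc (suc a)) (s≤s ())
⌊x/2⌋+row2 x (suc zero) _ = trans (cong (λ y → ⌊ x /2⌋ + (𝟙 (2 ≟ rowOfRank y) + 0)) (+-comm x 1))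
  (trans (next x) (cong ⌊_/2⌋ (+-comm 1 x)))
  where
  next : ∀ x → ⌊ x /2⌋ + (𝟙 (2 ≟ rowOfRank (suc x)) + 0) ≡ ⌊ suc x /2⌋
  next zero          = refl
  next (suc zero)    = refl
  next (suc (suc x)) = cong suc (next x)

increment≤ : ∀ {a x b c} → a + x ≡ b → b ≤ a + c → x ≤ c
increment≤ {a} a+x≡b b≤a+c = +-cancelˡ-≤ a _ _ (subst (_≤ _) (sym a+x≡b) b≤a+c)

increments≤ : ∀ {a b x y a′ b′ c₁ c₂} → a + x ≡ a′ → b + y ≡ b′ → a′ ≤ b + c₁ → b′ ≤ a + c₂ → x + y ≤ c₁ + c₂
increments≤ {a} {b} {x} {y} {a′} {b′} {c₁} {c₂} a+x≡a′ b+y≡b′ a′≤ b′≤ = +-cancelˡ-≤ (a + b) _ _ (begin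
  a + b + (x + y)       ≡⟨ +-interchange a b x y ⟩
  (a + x) + (b + y)     ≡⟨ cong₂ _+_ a+x≡a′ b+y≡b′ ⟩
  a′ + b′               ≤⟨ +-mono-≤ a′≤ b′≤ ⟩
  (b + c₁) + (a + c₂)   ≡⟨ regroup a b c₁ c₂ ⟩
  a + b + (c₁ + c₂)     ∎)
  where
  open ≤-Reasoning
  regroup : ∀ a b c₁ c₂ → (b + c₁) + (a + c₂) ≡ a + b + (c₁ + c₂)
  regroup = solve-∀

2[2+m]∸3≡1+2m : ∀ m → 2 * suc (suc m) ∸ 3 ≡ suc (2 * m)
2[2+m]∸3≡1+2m m = cong (_∸ 3) (trans (*-suc 2 (suc m)) (cong (2 +_) (*-suc 2 m)))

module AColumns (d : ℕ) .{{_ : NonZero d}} (m : ℕ) (K≤d : suc (2 * m) ≤ d) where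
  open Blocks d

  K : ℕ
  K = suc (2 * m)

  aCol : ℕ → ℕ
  aCol = blockPrefix K

  rank : ℕ → ℕ
  rank = sumFrom aCol 1

  rank-suc : ∀ c → rank (suc c) ≡ rank c + aCol (suc c)
  rank-suc c = sumFrom-suc aCol 1 c

  rank-suc≤ : ∀ c → rank (suc c) ≤ suc (rank c)
  rank-suc≤ c = ≤-trans (≤-reflexive (rank-suc c))
    (≤-trans (+-monoʳ-≤ (rank c) (blockPrefix≤1 K (suc c))) (≤-reflexive (+-comm (rank c) 1)))

  rank-+ : ∀ l w → rank (l + w) ≡ rank l + sumFrom aCol (suc l) w
  rank-+ l w = sumFrom-+ aCol 1 l w

  rank-window : ∀ l w → w ≤ d → rank (l + w) ≤ rank l + K
  rank-window l w w≤d = subst (_≤ rank l + K) (sym (rank-+ l w))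
    (+-monoʳ-≤ (rank l) (subst (sumFrom aCol (suc l) w ≤_) (m≥n⇒m⊓n≡n K≤d) (sumFrom-blockPrefix≤ K (suc l) w (s≤s z≤n) w≤d)))

  rank-window₁ : ∀ l w → w ≤ d → rank (l + suc w) ≤ rank l + 2 * suc m
  rank-window₁ l w w≤d = subst (_≤ rank l + 2 * suc m) (sym (rank-+ l (suc w)))
    (+-monoʳ-≤ (rank l) (subst (sumFrom aCol (suc l) (suc w) ≤_) (trans (cong suc (m≥n⇒m⊓n≡n K≤d)) (sym (*-suc 2 m)))
      (sumFrom-blockPrefix≤1+ K (suc l) w (s≤s z≤n) w≤d)))

  open OneRowPerColumn aCol (rowOfRank ∘ rank) (blockPrefix≤1 K) (rowOfRank-InRow ∘ rank) public

  prefix-row1 : ∀ c → sumFrom (marked OnRow? 1) 1 c ≡ ⌈ rank c /2⌉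
  prefix-row1 zero    = refl
  prefix-row1 (suc c) = begin
    sumFrom (marked OnRow? 1) 1 (suc c)
      ≡⟨ sumFrom-suc (marked OnRow? 1) 1 c ⟩
    sumFrom (marked OnRow? 1) 1 c + marked OnRow? 1 (suc c)
      ≡⟨ cong₂ _+_ (prefix-row1 c) (marked-OnRow 1 (suc c)) ⟩
    ⌈ rank c /2⌉ + aCol (suc c) * 𝟙 (1 ≟ rowOfRank (rank (suc c)))
      ≡⟨ cong (λ r → ⌈ rank c /2⌉ + aCol (suc c) * 𝟙 (1 ≟ rowOfRank r)) (rank-suc c) ⟩
    ⌈ rank c /2⌉ + aCol (suc c) * 𝟙 (1 ≟ rowOfRank (rank c + aCol (suc c)))
      ≡⟨ ⌈x/2⌉+row1 (rank c) (aCol (suc c)) (blockPrefix≤1 K (suc c)) ⟩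
    ⌈ rank c + aCol (suc c) /2⌉
      ≡⟨ cong ⌈_/2⌉ (sym (rank-suc c)) ⟩
    ⌈ rank (suc c) /2⌉ ∎
    where open ≡-Reasoning

  prefix-row2 : ∀ c → sumFrom (marked OnRow? 2) 1 c ≡ ⌊ rank c /2⌋
  prefix-row2 zero    = refl
  prefix-row2 (suc c) = begin
    sumFrom (marked OnRow? 2) 1 (suc c)
      ≡⟨ sumFrom-suc (marked OnRow? 2) 1 c ⟩
    sumFrom (marked OnRow? 2) 1 c + marked OnRow? 2 (suc c)
      ≡⟨ cong₂ _+_ (prefix-row2 c) (marked-OnRow 2 (suc c)) ⟩
    ⌊ rank c /2⌋ + aCol (suc c) * 𝟙 (2 ≟ rowOfRank (rank (suc c)))
      ≡⟨ cong (λ r → ⌊ rank c /2⌋ + aCol (suc c) * 𝟙 (2 ≟ rowOfRank r)) (rank-suc c) ⟩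
    ⌊ rank c /2⌋ + aCol (suc c) * 𝟙 (2 ≟ rowOfRank (rank c + aCol (suc c)))
      ≡⟨ ⌊x/2⌋+row2 (rank c) (aCol (suc c)) (blockPrefix≤1 K (suc c)) ⟩
    ⌊ rank c + aCol (suc c) /2⌋
      ≡⟨ cong ⌊_/2⌋ (sym (rank-suc c)) ⟩
    ⌊ rank (suc c) /2⌋ ∎
    where open ≡-Reasoning

  window-row1 : ∀ l w → ⌈ rank l /2⌉ + sumFrom (marked OnRow? 1) (suc l) w ≡ ⌈ rank (l + w) /2⌉
  window-row1 l w = trans (cong (_+ sumFrom (marked OnRow? 1) (suc l) w) (sym (prefix-row1 l)))
    (trans (sym (sumFrom-+ (marked OnRow? 1) 1 l w)) (prefix-row1 (l + w)))

  window-row2 : ∀ l w → ⌊ rank l /2⌋ + sumFrom (marked OnRow? 2) (suc l) w ≡ ⌊ rank (l + w) /2⌋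
  window-row2 l w = trans (cong (_+ sumFrom (marked OnRow? 2) (suc l) w) (sym (prefix-row2 l)))
    (trans (sym (sumFrom-+ (marked OnRow? 2) 1 l w)) (prefix-row2 (l + w)))

  rowPathsBounded : RowPathsBounded OnRow? d (suc m)
  rowPathsBounded (suc l) w 1 _ w≤d _ = subst (_≤ suc m) (sym (count-rowPath OnRow? 1 (suc l) w))
    (increment≤ (window-row1 l (suc w))
      (≤-trans (⌈n/2⌉-mono (rank-window₁ l w w≤d)) (≤-reflexive (⌈m+2n/2⌉≡⌈m/2⌉+n (rank l) (suc m)))))
  rowPathsBounded (suc l) w 2 _ w≤d _ = subst (_≤ suc m) (sym (count-rowPath OnRow? 2 (suc l) w))
    (increment≤ (window-row2 l (suc w))
      (≤-trans (⌊n/2⌋-mono (rank-window₁ l w w≤d)) (≤-reflexive (⌊m+2n/2⌋≡⌊m/2⌋+n (rank l) (suc m)))))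
  rowPathsBounded (suc l) w (suc (suc (suc _))) _ _ (_ , s≤s (s≤s ()))

  turn-rank≤ : ∀ l w₁ w₂ → suc (w₁ + w₂) ≤ d → rank (l + w₁ + suc w₂) ≤ rank l + K
  turn-rank≤ l w₁ w₂ w≤d = subst (λ c → rank c ≤ rank l + K) (sym (+-assoc l w₁ (suc w₂)))
    (rank-window l (w₁ + suc w₂) (subst (_≤ d) (sym (+-suc w₁ w₂)) w≤d))

  -- With p the column before the turn, rank (p + 1) ≤ rank p + 1 and the whole path spans at most K ranks.
  turnPathsBounded : TurnPathsBounded OnRow? d (suc m)
  turnPathsBounded (suc l) w₁ w₂ 1 2 _ w≤d _ _ _ = subst (_≤ suc m) (sym (count-turnPath OnRow? 1 2 (suc l) w₁ w₂))
    (increments≤ {c₁ = 1} {c₂ = m}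
      (trans (window-row1 l (suc w₁)) (cong (λ c → ⌈ rank c /2⌉) (+-suc l w₁))) (window-row2 (l + w₁) (suc w₂))
      (≤-trans (⌈n/2⌉-mono (rank-suc≤ (l + w₁))) (≤-reflexive (+-comm 1 _)))
      (≤-trans (⌊n/2⌋-mono (turn-rank≤ l w₁ w₂ w≤d))
        (≤-reflexive (trans (cong ⌊_/2⌋ (+-suc (rank l) (2 * m))) (⌈m+2n/2⌉≡⌈m/2⌉+n (rank l) m)))))
  turnPathsBounded (suc l) w₁ w₂ 2 1 _ w≤d _ _ _ = subst (_≤ suc m) (sym (count-turnPath OnRow? 2 1 (suc l) w₁ w₂))
    (increments≤ {c₁ = 0} {c₂ = suc m}
      (trans (window-row2 l (suc w₁)) (cong (λ c → ⌊ rank c /2⌋) (+-suc l w₁))) (window-row1 (l + w₁) (suc w₂))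
      (≤-trans (⌊n/2⌋-mono (rank-suc≤ (l + w₁))) (≤-reflexive (sym (+-identityʳ _))))
      (≤-trans (⌈n/2⌉-mono (turn-rank≤ l w₁ w₂ w≤d))
        (≤-reflexive (trans (cong ⌈_/2⌉ (+-suc (rank l) (2 * m)))
          (trans (⌊m+2n/2⌋≡⌊m/2⌋+n (suc (suc (rank l))) m) (sym (+-suc ⌊ rank l /2⌋ m)))))))
  turnPathsBounded (suc l) w₁ w₂ 1 1 _ _ _ _ 1≢1 = ⊥-elim (1≢1 refl)
  turnPathsBounded (suc l) w₁ w₂ 2 2 _ _ _ _ 2≢2 = ⊥-elim (2≢2 refl)
  turnPathsBounded (suc l) w₁ w₂ (suc (suc (suc _))) _ _ _ (_ , s≤s (s≤s ())) _ _
  turnPathsBounded (suc l) w₁ w₂ _ (suc (suc (suc _))) _ _ _ (_ , s≤s (s≤s ())) _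

  -- The row of A_{k,d} in column i, whose block index is s = (i ∸ 1) / d.
  paperRow : ℕ → ℕ
  paperRow i = 1 + (1 ∸ ((i + (i ∸ 1) / d) % 2))

  paperRow-InRow : ∀ i → InRow (paperRow i)
  paperRow-InRow i = s≤s z≤n , s≤s (m∸n≤m 1 ((i + (i ∸ 1) / d) % 2))

  module PaperA = OneRowPerColumn aCol paperRow (blockPrefix≤1 K) paperRow-InRow

  card-A : ∀ n {a} → Card (λ x → InA (suc (suc m)) d x × InV n x) a → a ≡ sumFrom aCol 1 n
  card-A n card = trans (Card⇒≡count PaperA.OnRow? n card InA⇒ ⇒InA) (PaperA.count-vertices-OnRow n)
    where
    InA⇒ : ∀ v → InA (suc (suc m)) d v × InV n v → PaperA.OnRow v × InV n v
    InA⇒ (i , j) ((s , (lo , hi) , j≡) , v∈V) =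
      let (i%d<K , i/d≡s) = inBlock⇒ K≤d lo (subst (λ x → i ≤ d * s + x) (2[2+m]∸3≡1+2m m) hi)
      in (𝟙-complete _ i%d<K , trans j≡ (cong (λ s → 1 + (1 ∸ ((i + s) % 2))) (sym i/d≡s))) , v∈V
    ⇒InA : ∀ v → PaperA.OnRow v → InV n v → InA (suc (suc m)) d v × InV n v
    ⇒InA (i , j) (inACol , j≡) v∈V@((1≤i , _) , _) =
      let (lo , hi) = ⇒inBlock 1≤i (𝟙-sound inACol)
      in ((i ∸ 1) / d , (lo , subst (λ x → i ≤ d * ((i ∸ 1) / d) + x) (sym (2[2+m]∸3≡1+2m m)) hi) , j≡) , v∈V

  A-witness : ∀ n → ∃[ S ] (IsGenPos n (suc (suc m)) d S × length S ≡ sumFrom aCol 1 n)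
  A-witness n with pathsBounded⇒genPosSet OnRow? {n} rowPathsBounded turnPathsBounded
  ... | S , genPos , length≡ = S , genPos , trans length≡ (count-vertices-OnRow n)

-- Upper bounds

searchUpTo : ∀ {P : ℕ → Set} → (∀ i → Dec (P i)) → ∀ q → (∃[ i ] (i ≤ q × P i)) ⊎ (∀ i → i ≤ q → ¬ P i)
searchUpTo P? zero with P? 0
... | yes p = inj₁ (0 , z≤n , p)
... | no ¬p = inj₂ λ { zero _ → ¬p ; (suc i) () }
searchUpTo {P} P? (suc q) with searchUpTo P? q | P? (suc q)
... | inj₁ (i , i≤q , p) | _     = inj₁ (i , m≤n⇒m≤1+n i≤q , p)
... | inj₂ _             | yes p = inj₁ (suc q , ≤-refl , p)
... | inj₂ none          | no ¬p = inj₂ λ i i≤1+q → case (m≤n⇒m<n∨m≡n i≤1+q)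
  where
  case : ∀ {i} → i < suc q ⊎ i ≡ suc q → ¬ P i
  case (inj₁ i<1+q) = none _ (≤-pred i<1+q)
  case (inj₂ refl)  = ¬p

module UpperBound {n d m : ℕ} {S : List Vert} (gp : IsGenPos n (suc (suc m)) d S) where

  colCount : ℕ → ℕ
  colCount c = marked (_∈? S) 1 c + marked (_∈? S) 2 c

  colCount≤2 : ∀ c → colCount c ≤ 2
  colCount≤2 c = +-mono-≤ (𝟙≤1 ((c , 1) ∈? S)) (𝟙≤1 ((c , 2) ∈? S))

  length≤sumFrom-colCount : length S ≤ sumFrom colCount 1 n
  length≤sumFrom-colCount = ≤-trans
    (Unique-⊆⇒length≤ (proj₁ (proj₁ gp)) λ x∈S →
      ∈.∈-filter⁺ (_∈? S) (∈-vertices n (All.lookup (proj₂ (proj₁ gp)) x∈S)) x∈S)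
    (≤-reflexive (count-vertices (_∈? S) n))

  turnPath-marks≤ : ∀ j j′ l w₁ w₂ → 1 ≤ l → l + w₁ + w₂ ≤ n → suc (w₁ + w₂) ≤ d → InRow j → InRow j′ → j ≢ j′ →
    sumFrom (marked (_∈? S) j) l (suc w₁) + sumFrom (marked (_∈? S) j′) (l + w₁) (suc w₂) ≤ suc m
  turnPath-marks≤ j j′ l w₁ w₂ 1≤l end≤n w≤d j∈ j′∈ j≢j′ = begin
    sumFrom (marked (_∈? S) j) l (suc w₁) + sumFrom (marked (_∈? S) j′) (l + w₁) (suc w₂)
      ≡⟨ count-turnPath (_∈? S) j j′ l w₁ w₂ ⟨
    count (_∈? S) (turnPath j j′ l w₁ w₂)
      ≤⟨ count≤countIn S (Unique-turnPath j j′ l w₁ w₂ j≢j′) ⟩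
    countIn S (turnPath j j′ l w₁ w₂)
      ≤⟨ IsGenPos⇒GeodesicsBounded gp _ (turnPath-Geodesic n j j′ l w₁ w₂ 1≤l end≤n j∈ j′∈ j≢j′)
           (subst (_≤ d) (sym (λ-len-turnPath j j′ l w₁ w₂)) w≤d) ⟩
    suc m ∎
    where open ≤-Reasoning

  -- The two turn paths switching rows at column l + w₁ together cover each column of the window
  -- once in each row, and column l + w₁ twice more.
  window+turnColumn≤ : ∀ l w₁ w₂ → 1 ≤ l → l + w₁ + w₂ ≤ n → suc (w₁ + w₂) ≤ d →
    sumFrom colCount l (w₁ + suc w₂) + colCount (l + w₁) ≤ suc m + suc m
  window+turnColumn≤ l w₁ w₂ 1≤l end≤n w≤d = begin
    sumFrom colCount l (w₁ + suc w₂) + colCount (l + w₁)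
      ≡⟨ sumFrom-split-at colCount l w₁ w₂ ⟨
    sumFrom colCount l (suc w₁) + sumFrom colCount (l + w₁) (suc w₂)
      ≡⟨ cong₂ _+_ (sumFrom-+-distrib row₁ row₂ l (suc w₁)) (sumFrom-+-distrib row₁ row₂ (l + w₁) (suc w₂)) ⟩
    (sumFrom row₁ l (suc w₁) + sumFrom row₂ l (suc w₁)) + (sumFrom row₁ (l + w₁) (suc w₂) + sumFrom row₂ (l + w₁) (suc w₂))
      ≡⟨ regroup (sumFrom row₁ l (suc w₁)) (sumFrom row₂ l (suc w₁)) _ (sumFrom row₂ (l + w₁) (suc w₂)) ⟩
    (sumFrom row₁ l (suc w₁) + sumFrom row₂ (l + w₁) (suc w₂)) + (sumFrom row₂ l (suc w₁) + sumFrom row₁ (l + w₁) (suc w₂))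
      ≤⟨ +-mono-≤ (turnPath-marks≤ 1 2 l w₁ w₂ 1≤l end≤n w≤d (≤-refl , s≤s z≤n) (s≤s z≤n , ≤-refl) (λ ()))
                  (turnPath-marks≤ 2 1 l w₁ w₂ 1≤l end≤n w≤d (s≤s z≤n , ≤-refl) (≤-refl , s≤s z≤n) (λ ())) ⟩
    suc m + suc m ∎
    where
    open ≤-Reasoning
    row₁ = marked (_∈? S) 1
    row₂ = marked (_∈? S) 2
    regroup : ∀ a b c e → (a + b) + (c + e) ≡ (a + e) + (b + c)
    regroup = solve-∀

  Window : ℕ → ℕ → Set
  Window l w = 1 ≤ l × l + w ≤ suc n × w ≤ d

  window-sum+max≤ : ∀ l w → Window l w → sumFrom colCount l w + maxFrom colCount l w ≤ suc m + suc m
  window-sum+max≤ l zero    _                    = z≤n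
  window-sum+max≤ l (suc w) (1≤l , end≤1+n , w≤d) with maxFrom-attained colCount l (suc w) (s≤s z≤n)
  ... | t , l≤t , t<end , colCount-t≡max =
    subst₂ (λ v x → sumFrom colCount l v + x ≤ suc m + suc m) w₁+1+w₂≡w (trans (cong colCount l+w₁≡t) colCount-t≡max)
      (window+turnColumn≤ l w₁ w₂ 1≤l end≤n (subst (_≤ d) (sym 1+w₁+w₂≡w) w≤d))
    where
    w₁ = t ∸ l
    l+w₁≡t : l + w₁ ≡ t
    l+w₁≡t = m+[n∸m]≡n l≤t
    1+w₁≤w : suc w₁ ≤ suc w
    1+w₁≤w = +-cancelˡ-≤ l _ _ (subst (_≤ l + suc w) (trans (cong suc (sym l+w₁≡t)) (sym (+-suc l w₁))) t<end)
    w₂ = suc w ∸ suc w₁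
    w₁+1+w₂≡w : w₁ + suc w₂ ≡ suc w
    w₁+1+w₂≡w = trans (+-suc w₁ w₂) (m+[n∸m]≡n 1+w₁≤w)
    1+w₁+w₂≡w : suc (w₁ + w₂) ≡ suc w
    1+w₁+w₂≡w = trans (sym (+-suc w₁ w₂)) w₁+1+w₂≡w
    end≤n : l + w₁ + w₂ ≤ n
    end≤n = ≤-pred (subst (_≤ suc n)
      (trans (cong (l +_) (sym 1+w₁+w₂≡w)) (trans (+-suc l (w₁ + w₂)) (cong suc (sym (+-assoc l w₁ w₂))))) end≤1+n)

  window-sum≤K : ∀ l w → Window l w → sumFrom colCount l w ≤ suc (2 * m)
  window-sum≤K l w window = bound (maxFrom colCount l w) (sumFrom≤length*maxFrom colCount l w)
    (subst (sumFrom colCount l w + maxFrom colCount l w ≤_) (2[1+m]≡2+2m m) (window-sum+max≤ l w window))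
    where
    2[1+m]≡2+2m : ∀ m → suc m + suc m ≡ suc (suc (2 * m))
    2[1+m]≡2+2m = solve-∀
    bound : ∀ M → sumFrom colCount l w ≤ w * M → sumFrom colCount l w + M ≤ suc (suc (2 * m)) → sumFrom colCount l w ≤ suc (2 * m)
    bound zero    sum≤0 _   = ≤-trans sum≤0 (≤-trans (≤-reflexive (*-zeroʳ w)) z≤n)
    bound (suc M) _     sum+M≤ = ≤-pred (≤-trans (s≤s (m≤m+n _ M)) (subst (_≤ suc (suc (2 * m))) (+-suc _ M) sum+M≤))

  heavy-window-sum≤2m : ∀ l w → Window l w → 2 ≤ maxFrom colCount l w → sumFrom colCount l w ≤ 2 * m
  heavy-window-sum≤2m l w window 2≤max = +-cancelˡ-≤ 2 _ _
    (subst (_≤ 2 + 2 * m) (+-comm (sumFrom colCount l w) 2)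
      (≤-trans (+-monoʳ-≤ (sumFrom colCount l w) 2≤max)
        (subst (sumFrom colCount l w + maxFrom colCount l w ≤_) (2[1+m]≡2+2m m) (window-sum+max≤ l w window))))
    where
    2[1+m]≡2+2m : ∀ m → suc m + suc m ≡ 2 + 2 * m
    2[1+m]≡2+2m = solve-∀

  light-window-sum≤w : ∀ l w → maxFrom colCount l w ≤ 1 → sumFrom colCount l w ≤ w
  light-window-sum≤w l w max≤1 =
    ≤-trans (sumFrom≤length*maxFrom colCount l w) (≤-trans (*-monoʳ-≤ w max≤1) (≤-reflexive (*-identityʳ w)))

  window-sum≤2w : ∀ l w → sumFrom colCount l w ≤ w + w
  window-sum≤2w l w = ≤-trans (sumFrom-≤-* colCount l w 2 (λ i _ → colCount≤2 (l + i))) (≤-reflexive (w*2≡w+w w))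
    where
    w*2≡w+w : ∀ w → w * 2 ≡ w + w
    w*2≡w+w = solve-∀

  window-sum≤w⊓K : ∀ l w → Window l w → maxFrom colCount l w ≤ 1 ⊎ suc (2 * m) ≤ w →
    sumFrom colCount l w ≤ w ⊓ suc (2 * m)
  window-sum≤w⊓K l w window (inj₁ max≤1) = ⊓-glb (light-window-sum≤w l w max≤1) (window-sum≤K l w window)
  window-sum≤w⊓K l w window (inj₂ K≤w)   = ⊓-glb (≤-trans (window-sum≤K l w window) K≤w) (window-sum≤K l w window)

  window-sum≤2[w⊓m] : ∀ l w → Window l w → 2 ≤ maxFrom colCount l w ⊎ w ≤ 2 * m →
    sumFrom colCount l w ≤ w ⊓ m + w ⊓ m
  window-sum≤2[w⊓m] l w window heavy⊎short with ≤-total w m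
  ... | inj₁ w≤m = subst (λ x → sumFrom colCount l w ≤ x + x) (sym (m≤n⇒m⊓n≡m w≤m)) (window-sum≤2w l w)
  ... | inj₂ m≤w = subst (λ x → sumFrom colCount l w ≤ x + x) (sym (m≥n⇒m⊓n≡n m≤w))
    (≤-trans (sum≤2m heavy⊎short) (≤-reflexive (2m≡m+m m)))
    where
    2m≡m+m : ∀ m → 2 * m ≡ m + m
    2m≡m+m = solve-∀
    sum≤2m : 2 ≤ maxFrom colCount l w ⊎ w ≤ 2 * m → sumFrom colCount l w ≤ 2 * m
    sum≤2m (inj₁ 2≤max) = heavy-window-sum≤2m l w window 2≤max
    sum≤2m (inj₂ w≤2m) with 2 ≤? maxFrom colCount l w
    ... | yes 2≤max = heavy-window-sum≤2m l w window 2≤max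
    ... | no 2≰max  = ≤-trans (light-window-sum≤w l w (≤-pred (≰⇒> 2≰max))) w≤2m

module SizeBounds {n d m : ℕ} .{{_ : NonZero d}} {S : List Vert} (gp : IsGenPos n (suc (suc m)) d S) where
  open UpperBound gp
  open Blocks d

  K : ℕ
  K = suc (2 * m)

  short-B : n ≤ d → n ≤ 2 * m → length S ≤ sumFrom (blockPrefix m) 1 n + sumFrom (blockPrefix m) 1 n
  short-B n≤d n≤2m = ≤-trans length≤sumFrom-colCount
    (subst (λ x → sumFrom colCount 1 n ≤ x + x) (sym (sumFrom-blockPrefix-aligned m 0 n n≤d))
      (window-sum≤2[w⊓m] 1 n (≤-refl , ≤-refl , n≤d) (inj₂ n≤2m)))

  short-A : n ≤ d → K ≤ n → length S ≤ sumFrom (blockPrefix K) 1 n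
  short-A n≤d K≤n = ≤-trans length≤sumFrom-colCount
    (subst (sumFrom colCount 1 n ≤_) (sym (sumFrom-blockPrefix-aligned K 0 n n≤d))
      (window-sum≤w⊓K 1 n (≤-refl , ≤-refl , n≤d) (inj₂ K≤n)))

  q r : ℕ
  q = n / d
  r = n % d

  n≡q*d+r : n ≡ q * d + r
  n≡q*d+r = trans (m≡m%n+[m/n]*n n d) (+-comm r (q * d))

  r≤d : r ≤ d
  r≤d = <⇒≤ (m%n<n n d)

  block-Window : ∀ i → i < q → Window (1 + i * d) d
  block-Window i i<q = s≤s z≤n ,
    subst₂ _≤_ (sym (1+id+d i d)) (cong suc (sym n≡q*d+r)) (s≤s (≤-trans (*-monoˡ-≤ d i<q) (m≤m+n (q * d) r))) , ≤-refl
    where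
    1+id+d : ∀ i d → 1 + i * d + d ≡ suc (d + i * d)
    1+id+d = solve-∀

  remainder-Window : ∀ i → i ≤ q → Window (1 + i * d) r
  remainder-Window i i≤q = s≤s z≤n ,
    subst (1 + i * d + r ≤_) (cong suc (sym n≡q*d+r)) (s≤s (+-monoˡ-≤ r (*-monoˡ-≤ d i≤q))) , r≤d

  sumFrom-blockPrefix-n : ∀ L → L ≤ d → sumFrom (blockPrefix L) 1 n ≡ q * L + r ⊓ L
  sumFrom-blockPrefix-n L L≤d = trans (cong (sumFrom (blockPrefix L) 1) n≡q*d+r)
    (trans (sumFrom-blockPrefix L q 0 r r≤d) (cong (λ x → q * x + r ⊓ L) (m≥n⇒m⊓n≡n L≤d)))

  heavy-B : m ≤ d → (∀ i → i < q → sumFrom colCount (1 + i * d) d ≤ 2 * m) →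
    sumFrom colCount (1 + q * d) r ≤ r ⊓ m + r ⊓ m →
    length S ≤ sumFrom (blockPrefix m) 1 n + sumFrom (blockPrefix m) 1 n
  heavy-B m≤d blocks≤ remainder≤ = begin
    length S
      ≤⟨ length≤sumFrom-colCount ⟩
    sumFrom colCount 1 n
      ≡⟨ cong (sumFrom colCount 1) n≡q*d+r ⟩
    sumFrom colCount 1 (q * d + r)
      ≡⟨ sumFrom-+ colCount 1 (q * d) r ⟩
    sumFrom colCount 1 (q * d) + sumFrom colCount (1 + q * d) r
      ≤⟨ +-mono-≤ (sumFrom-blocks colCount (2 * m) d q 1 blocks≤) remainder≤ ⟩
    q * (2 * m) + (r ⊓ m + r ⊓ m)
      ≡⟨ double q m (r ⊓ m) ⟩
    (q * m + r ⊓ m) + (q * m + r ⊓ m)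
      ≡⟨ sym (cong₂ _+_ (sumFrom-blockPrefix-n m m≤d) (sumFrom-blockPrefix-n m m≤d)) ⟩
    sumFrom (blockPrefix m) 1 n + sumFrom (blockPrefix m) 1 n ∎
    where
    open ≤-Reasoning
    double : ∀ q m x → q * (2 * m) + (x + x) ≡ (q * m + x) + (q * m + x)
    double = solve-∀

  dense-B : d ≤ 2 * m → m ≤ d → length S ≤ sumFrom (blockPrefix m) 1 n + sumFrom (blockPrefix m) 1 n
  dense-B d≤2m m≤d = heavy-B m≤d block≤
    (window-sum≤2[w⊓m] (1 + q * d) r (remainder-Window q ≤-refl) (inj₂ (≤-trans r≤d d≤2m)))
    where
    block≤ : ∀ i → i < q → sumFrom colCount (1 + i * d) d ≤ 2 * m
    block≤ i i<q with 2 ≤? maxFrom colCount (1 + i * d) d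
    ... | yes 2≤max = heavy-window-sum≤2m (1 + i * d) d (block-Window i i<q) 2≤max
    ... | no 2≰max  = ≤-trans (light-window-sum≤w (1 + i * d) d (≤-pred (≰⇒> 2≰max))) d≤2m

  -- Some remainder-length window starting a block is light: the columns split into i blocks, that light
  -- window, and e further windows of length d, each holding at most K vertices.
  light-A : K ≤ d → ∀ i → i ≤ q → maxFrom colCount (1 + i * d) r ≤ 1 → length S ≤ sumFrom (blockPrefix K) 1 n
  light-A K≤d i i≤q light = begin
    length S                                                  ≤⟨ length≤sumFrom-colCount ⟩
    sumFrom colCount 1 n                                      ≡⟨ cong (sumFrom colCount 1) n≡id+r+ed ⟩
    sumFrom colCount 1 (i * d + (r + e * d))                  ≡⟨ sumFrom-+ colCount 1 (i * d) (r + e * d) ⟩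
    sumFrom colCount 1 (i * d) + sumFrom colCount (1 + i * d) (r + e * d)
      ≡⟨ cong (sumFrom colCount 1 (i * d) +_) (sumFrom-+ colCount (1 + i * d) r (e * d)) ⟩
    sumFrom colCount 1 (i * d) + (sumFrom colCount (1 + i * d) r + sumFrom colCount (1 + i * d + r) (e * d))
      ≤⟨ +-mono-≤ (sumFrom-blocks colCount K d i 1 before)
           (+-mono-≤ (window-sum≤w⊓K (1 + i * d) r (remainder-Window i i≤q) (inj₁ light))
                     (sumFrom-blocks colCount K d e (1 + i * d + r) after)) ⟩
    i * K + (r ⊓ K + e * K)                                   ≡⟨ regroup i e (r ⊓ K) K ⟩
    (i + e) * K + r ⊓ K                                       ≡⟨ cong (λ x → x * K + r ⊓ K) (sym q≡i+e) ⟩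
    q * K + r ⊓ K                                             ≡⟨ sym (sumFrom-blockPrefix-n K K≤d) ⟩
    sumFrom (blockPrefix K) 1 n                               ∎
    where
    open ≤-Reasoning
    e = q ∸ i
    q≡i+e : q ≡ i + e
    q≡i+e = sym (m+[n∸m]≡n i≤q)
    n≡id+r+ed : n ≡ i * d + (r + e * d)
    n≡id+r+ed = trans n≡q*d+r (trans (cong (λ x → x * d + r) q≡i+e) (reorder i e d r))
      where
      reorder : ∀ i e d r → (i + e) * d + r ≡ i * d + (r + e * d)
      reorder = solve-∀
    regroup : ∀ i e x K → i * K + (x + e * K) ≡ (i + e) * K + x
    regroup = solve-∀
    before : ∀ i′ → i′ < i → sumFrom colCount (1 + i′ * d) d ≤ K
    before i′ i′<i = window-sum≤K (1 + i′ * d) d (block-Window i′ (≤-trans i′<i i≤q))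
    after : ∀ i′ → i′ < e → sumFrom colCount (1 + i * d + r + i′ * d) d ≤ K
    after i′ i′<e = window-sum≤K _ d (s≤s z≤n ,
      subst₂ _≤_ (sym (shift i i′ d r)) (trans (cong (λ x → suc (x * d + r)) (sym q≡i+e)) (cong suc (sym n≡q*d+r)))
        (s≤s (+-monoˡ-≤ r (*-monoˡ-≤ d (+-monoʳ-≤ i i′<e)))) , ≤-refl)
      where
      shift : ∀ i i′ d r → 1 + i * d + r + i′ * d + d ≡ suc ((i + suc i′) * d + r)
      shift = solve-∀

  long-A⊔B : K ≤ d → m ≤ d →
    length S ≤ sumFrom (blockPrefix K) 1 n ⊔ (sumFrom (blockPrefix m) 1 n + sumFrom (blockPrefix m) 1 n)
  long-A⊔B K≤d m≤d with searchUpTo (λ i → maxFrom colCount (1 + i * d) r ≤? 1) q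
  ... | inj₁ (i , i≤q , light) = ≤-trans (light-A K≤d i i≤q light) (m≤m⊔n _ _)
  ... | inj₂ heavy = ≤-trans (heavy-B m≤d block≤ (window-sum≤2[w⊓m] (1 + q * d) r (remainder-Window q ≤-refl) (inj₁ (2≤max q ≤-refl))))
                             (m≤n⊔m _ _)
    where
    2≤max : ∀ i → i ≤ q → 2 ≤ maxFrom colCount (1 + i * d) r
    2≤max i i≤q = ≰⇒> (heavy i i≤q)
    block≤ : ∀ i → i < q → sumFrom colCount (1 + i * d) d ≤ 2 * m
    block≤ i i<q = heavy-window-sum≤2m (1 + i * d) d (block-Window i i<q)
      (≤-trans (2≤max i (<⇒≤ i<q)) (maxFrom-monoʳ-≤ colCount (1 + i * d) r≤d))

GpEq-⊔ : ∀ {n k d x y} → ∃[ S ] (IsGenPos n k d S × length S ≡ x) → ∃[ S ] (IsGenPos n k d S × length S ≡ y) →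
  (∀ S → IsGenPos n k d S → length S ≤ x ⊔ y) → GpEq n k d (x ⊔ y)
GpEq-⊔ {x = x} {y} (S , gp , |S|≡x) (T , gp′ , |T|≡y) bound with ≤-total x y
... | inj₁ x≤y = (T , gp′ , trans |T|≡y (sym (m≤n⇒m⊔n≡n x≤y))) , bound
... | inj₂ y≤x = (S , gp , trans |S|≡x (sym (m≥n⇒m⊔n≡m y≤x))) , bound

theorem6p7 : (d k n : ℕ) → 1 ≤ d → 1 ≤ n → k ≥ 4 → d ≥ k ∸ 1 →
    (a b : ℕ) → Card (λ x → InA k d x × InV n x) a → Card (λ x → InB k d x × InV n x) b →
    ((n ≤ d → (n < 2 * k ∸ 3 → GpEq n k d b) × (n ≥ 2 * k ∸ 3 → GpEq n k d a)) ×
     (n ≥ d + 1 → d < 2 * k ∸ 3 → GpEq n k d b) ×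
     (n ≥ d + 1 → d ≥ 2 * k ∸ 3 → GpEq n k d (a ⊔ b)))
-- The hypothesis k ≥ 4 is only used to write k = m + 2.
theorem6p7 zero          _                n ()
theorem6p7 (suc _)       0                n _ _ ()
theorem6p7 (suc _)       1                n _ _ (s≤s ())
theorem6p7 d@(suc _)     k@(suc (suc m))  n _ _ _ m<d a b cardA cardB =
  (λ n≤d → (λ n<2k-3 → gp-B λ S gp → short-B gp n≤d (≤-pred (subst (n <_) 2k-3≡K n<2k-3))) ,
           (λ 2k-3≤n → let K≤n = subst (_≤ n) 2k-3≡K 2k-3≤n in gp-A (≤-trans K≤n n≤d) λ S gp → short-A gp n≤d K≤n)) ,
  (λ _ d<2k-3 → gp-B λ S gp → dense-B gp (≤-pred (subst (d <_) 2k-3≡K d<2k-3)) m≤d) ,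
  (λ _ 2k-3≤d → gp-A⊔B (subst (_≤ d) 2k-3≡K 2k-3≤d))
  where
  open Blocks d
  open SizeBounds
  m≤d = <⇒≤ m<d
  open BColumns d m m≤d
  2k-3≡K = 2[2+m]∸3≡1+2m m
  b≡ = card-B n cardB
  gp-B : (∀ S → IsGenPos n k d S → length S ≤ sumFrom (blockPrefix m) 1 n + sumFrom (blockPrefix m) 1 n) → GpEq n k d b
  gp-B bound = subst (GpEq n k d) (sym b≡) (B-witness n , bound)
  gp-A : (K≤d : suc (2 * m) ≤ d) → (∀ S → IsGenPos n k d S → length S ≤ sumFrom (blockPrefix (suc (2 * m))) 1 n) → GpEq n k d a
  gp-A K≤d bound = let open AColumns d m K≤d in subst (GpEq n k d) (sym (card-A n cardA)) (A-witness n , bound)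
  gp-A⊔B : suc (2 * m) ≤ d → GpEq n k d (a ⊔ b)
  gp-A⊔B K≤d = let open AColumns d m K≤d in subst (GpEq n k d) (sym (cong₂ _⊔_ (card-A n cardA) b≡))
    (GpEq-⊔ (A-witness n) (B-witness n) λ S gp → long-A⊔B gp K≤d m≤d)
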